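{- Let $l,m,n\ge 0$ be integers and let $\Sigma=(-K_l)\vee_{+}(-K_m)\vee_{+}(-K_n)$. Then \[ \mathsf E(\Sigma,x)=H_2(l,m,n,x), \] \[ \mathsf O(\Sigma,x)=\mathsf E(\Sigma,x-1)+l\,H_2(l-1,m,n,x-1)+m\,H_2(l,m-1,n,x-1)+n\,H_2(l,m,n-1,x-1). \]
   Context: A signed graph $\Sigma=(\Gamma,\sigma)$ is a finite simple graph $\Gamma$ with a signature $\sigma:E(\Gamma)\to\{\pm1\}$. $-K_n$ is the complete graph on $n$ vertices with all edges negative ($K_0$ is the empty signed graph). For signed graphs $\Sigma_1,\Sigma_2$ on disjoint vertex sets, the all-positive join $\Sigma_1\vee_{+}\Sigma_2$ is obtained from their disjoint union by joining every vertex of $\Sigma_1$ to every vertex of $\Sigma_2$ by a positive edge (associative; joining with $K_0$ does nothing). For an integer $\lambda\ge 0$, let $C_\lambda$ be the set of nonzero integers in $[-\lambda/2,\lambda/2]$ if $\lambda$ is even, and the set of integers in $[-(\lambda-1)/2,(\lambda-1)/2]$ if $\lambda$ is odd. A proper $C_\lambda$-colouring of $\Sigma$ is a map $\kappa:V(\Gamma)\to C_\lambda$ with $\kappa(v)\ne\sigma(\{v,w\})\kappa(w)$ for every edge $\{v,w\}$; $f(\Sigma,\lambda)$ denotes their number. $\mathsf E(\Sigma,x),\mathsf O(\Sigma,x)\in\mathbb Z[x]$ are the unique polynomials with $f(\Sigma,\lambda)=\mathsf E(\Sigma,\lambda)$ for all even $\lambda\ge0$ and $f(\Sigma,\lambda)=\mathsf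 O(\Sigma,\lambda)$ for all odd $\lambda\ge0$. Notation: $(x)_n=\prod_{j=0}^{n-1}(x-j)$, ${}_2(x)_n=\prod_{j=0}^{n-1}(x-2j)$ (both $1$ for $n=0$); $S(n,k)$ is the Stirling number of the second kind ($S(0,0)=1$). For integers $l,m,n\ge0$, \[ H_2(l,m,n,x)=\sum_{i=0}^{l}\sum_{j=0}^{m}\sum_{k=0}^{n}\sum_{s=0}^{\min(i,j)}\sum_{t=0}^{k} s!\binom{i}{s}\binom{j}{s}\binom{k}{t}S(l,i)S(m,j)S(n,k)\,{}_2(x)_{i+j+k-t-s}\,(i+j-2s)_t, \] and $H_2(l,m,n,x)=0$ if any of $l,m,n$ is negative. -}

module Defs where

open import Data.Bool using (Bool; true; false; not; _∧_; if_then_else_)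
open import Data.Nat as ℕ using (ℕ; zero; suc; _∸_)
open import Data.Nat.Combinatorics using (_C_)
open import Data.Nat using (_!)
open import Data.Integer as ℤ using (ℤ; +_; -[1+_]; _+_; _*_; _-_; -_)
open import Data.Fin using (Fin; splitAt)
open import Data.Fin.Properties using () renaming (_≟_ to _≟ᶠ_)
open import Data.Integer.Properties using () renaming (_≟_ to _≟ℤ_)
open import Data.List using (List; []; _∷_; _++_; map; concatMap; length; filterᵇ; upTo; allFin; foldr)
open import Data.Vec using (Vec; []; _∷_; lookup)
open import Data.Maybe using (Maybe; just; nothing)
open import Data.Sum using (inj₁; inj₂)
open import Relation.Nullary using (does)
open import Relation.Binary.PropositionalEquality using (_≡_; refl)

data Sign : Set where
  pos neg : Sign

record SignedGraph : Set where
  field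
    nv     : ℕ
    edge   : Fin nv → Fin nv → Maybe Sign
    sym    : ∀ u v → edge u v ≡ edge v u
    irrefl : ∀ v → edge v v ≡ nothing
open SignedGraph public

negK : ℕ → SignedGraph
negK n = record { nv = n ; edge = e ; sym = s ; irrefl = i }
  where
  e : Fin n → Fin n → Maybe Sign
  e u v = if does (u ≟ᶠ v) then nothing else just neg
  s : ∀ u v → e u v ≡ e v u
  s u v with u ≟ᶠ v | v ≟ᶠ u
  ... | Relation.Nullary.yes _ | Relation.Nullary.yes _ = refl
  ... | Relation.Nullary.no _  | Relation.Nullary.no _  = refl
  ... | Relation.Nullary.yes refl | Relation.Nullary.no q = Data.Empty.⊥-elim (q refl)
    where import Data.Empty
  ... | Relation.Nullary.no q | Relation.Nullary.yes refl = Data.Empty.⊥-elim (q refl)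
    where import Data.Empty
  i : ∀ v → e v v ≡ nothing
  i v with v ≟ᶠ v
  ... | Relation.Nullary.yes _ = refl
  ... | Relation.Nullary.no q = Data.Empty.⊥-elim (q refl)
    where import Data.Empty

_∨₊_ : SignedGraph → SignedGraph → SignedGraph
G ∨₊ H = record { nv = nv G ℕ.+ nv H ; edge = e ; sym = s ; irrefl = i }
  where
  e : Fin (nv G ℕ.+ nv H) → Fin (nv G ℕ.+ nv H) → Maybe Sign
  e u v with splitAt (nv G) u | splitAt (nv G) v
  ... | inj₁ x | inj₁ y = edge G x y
  ... | inj₂ x | inj₂ y = edge H x y
  ... | inj₁ _ | inj₂ _ = just pos
  ... | inj₂ _ | inj₁ _ = just pos
  s : ∀ u v → e u v ≡ e v u
  s u v with splitAt (nv G) u | splitAt (nv G) v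
  ... | inj₁ x | inj₁ y = sym G x y
  ... | inj₂ x | inj₂ y = sym H x y
  ... | inj₁ _ | inj₂ _ = refl
  ... | inj₂ _ | inj₁ _ = refl
  i : ∀ v → e v v ≡ nothing
  i v with splitAt (nv G) v
  ... | inj₁ x = irrefl G x
  ... | inj₂ x = irrefl H x

infixr 5 _∨₊_

-- C_λ : nonzero integers in [-λ/2, λ/2] (λ even), integers in
-- [-(λ-1)/2, (λ-1)/2] (λ odd). With k = ⌊λ/2⌋ both are ±1..±k, plus 0 if λ odd.
colourSet : ℕ → List ℤ
colourSet lam =
  (if does ((lam ℕ.% 2) ℕ.≟ 1) then (+ 0 ∷ []) else [])
  ++ concatMap (λ i → + suc i ∷ - (+ suc i) ∷ []) (upTo (lam ℕ./ 2))

allVecs : {A : Set} → List A → (N : ℕ) → List (Vec A N)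
allVecs xs zero = [] ∷ []
allVecs xs (suc N) = concatMap (λ x → map (x ∷_) (allVecs xs N)) xs

signed : Sign → ℤ → ℤ
signed pos z = z
signed neg z = - z

allᵇ : {A : Set} → (A → Bool) → List A → Bool
allᵇ p = foldr (λ x b → p x ∧ b) true

isProper : (G : SignedGraph) → Vec ℤ (nv G) → Bool
isProper G κ = allᵇ (λ u → allᵇ (λ v → ok (edge G u v) u v) (allFin (nv G))) (allFin (nv G))
  where
  ok : Maybe Sign → Fin (nv G) → Fin (nv G) → Bool
  ok nothing  u v = true
  ok (just s) u v = not (does (lookup κ u ≟ℤ signed s (lookup κ v)))

chromatic : SignedGraph → ℕ → ℕ
chromatic G lam = length (filterᵇ (isProper G) (allVecs (colourSet lam) (nv G)))

sumTo : ℕ → (ℕ → ℤ) → ℤ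
sumTo zero f = f 0
sumTo (suc n) f = sumTo n f + f (suc n)

stirling2 : ℕ → ℕ → ℕ
stirling2 zero zero = 1
stirling2 zero (suc k) = 0
stirling2 (suc n) zero = 0
stirling2 (suc n) (suc k) = suc k ℕ.* stirling2 n (suc k) ℕ.+ stirling2 n k

falling : ℤ → ℕ → ℤ
falling x zero = + 1
falling x (suc n) = falling x n * (x - + n)

falling2 : ℤ → ℕ → ℤ
falling2 x zero = + 1
falling2 x (suc n) = falling2 x n * (x - + (2 ℕ.* n))

H₂ : ℕ → ℕ → ℕ → ℤ → ℤ
H₂ l m n x =
  sumTo l λ i → sumTo m λ j → sumTo n λ k → sumTo (ℕ._⊓_ i j) λ s → sumTo k λ t →
    + ((s !) ℕ.* (i C s) ℕ.* (j C s) ℕ.* (k C t)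
        ℕ.* stirling2 l i ℕ.* stirling2 m j ℕ.* stirling2 n k)
    * falling2 x (i ℕ.+ j ℕ.+ k ∸ t ∸ s)
    * falling (+ (i ℕ.+ j ∸ 2 ℕ.* s)) t

H₂ℤ : ℤ → ℤ → ℤ → ℤ → ℤ
H₂ℤ (+ l) (+ m) (+ n) x = H₂ l m n x
H₂ℤ _ _ _ _ = + 0

tripleJoin : ℕ → ℕ → ℕ → SignedGraph
tripleJoin l m n = negK l ∨₊ negK m ∨₊ negK n

module Submission where

open import Algebra.Bundles using (CommutativeMonoid)
open import Data.Bool using (Bool; true; false; not; _∧_; if_then_else_)
open import Data.Bool.Properties
  using (∧-inverseʳ; ∧-zeroʳ; ∧-identityʳ; ∧-assoc; ∧-comm; ∧-commutativeMonoid; if-eta)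
open import Algebra.Properties.CommutativeSemigroup (CommutativeMonoid.commutativeSemigroup ∧-commutativeMonoid)
  using () renaming (interchange to ∧-interchange)
open import Data.Fin as Fin using (Fin; splitAt; _↑ˡ_; _↑ʳ_)
open import Data.Fin.Properties using (splitAt⁻¹-↑ˡ; splitAt⁻¹-↑ʳ) renaming (_≟_ to _≟ᶠ_)
open import Data.Integer as ℤ using (ℤ; +_; -[1+_]; _+_; _*_; _-_; -_)
open import Data.Integer.Properties using (_≟_)
import Data.Integer.Properties as ℤ
open import Data.Integer.Tactic.RingSolver using (solve-∀)
open import Data.List
  using (List; []; _∷_; _++_; replicate; map; concatMap; length; filterᵇ; upTo; applyUpTo; allFin; tabulate)
import Data.List.Properties as List
open import Data.List.Relation.Unary.All as All using (All; []; _∷_)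
open import Data.Maybe using (Maybe; just; nothing; is-nothing)
open import Data.Nat as ℕ using (ℕ; zero; suc; pred; _≤_; _<_; z≤n; s≤s; _!; _∸_; _⊓_)
import Data.Nat.Properties as ℕ
open import Data.Nat.Combinatorics using (_C_; nCk+nC[k+1]≡[n+1]C[k+1]; k>n⇒nCk≡0)
import Data.Nat.DivMod as ℕ
open import Data.Nat.Divisibility using (divides)
open import Data.Nat.Tactic.RingSolver using () renaming (solve-∀ to ℕ-solve-∀)
open import Data.Product using (_×_; _,_; proj₂)
open import Data.Sum using (inj₁; inj₂; [_,_]′)
open import Data.Sum.Properties using (inj₁-injective; inj₂-injective)
open import Data.Vec as V using (Vec; []; _∷_)
import Data.Vec.Properties as V
open import Function using (case_of_)
open import Function.Bundles using (mk⇔)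
open import Relation.Binary.Definitions using (DecidableEquality)
open import Relation.Binary.PropositionalEquality
  using (_≡_; _≢_; refl; sym; trans; cong; cong₂; subst; module ≡-Reasoning)
open import Relation.Nullary using (yes; no; does)
open import Relation.Nullary.Decidable using (dec-true; dec-false; does-⇔)
open ≡-Reasoning

open import Defs hiding (sym)

-- Colour the vertices one at a time, part by part, and group the colours into pairs {c, -c}.
-- Properness forbids giving c and -c to one part and one colour to two parts, so all that
-- matters about the colours used so far is, for each pair, which parts own its two colours; the
-- numbers of pairs of each kind form a profile. From a profile, the next vertex can reuse a
-- colour of its own part, take a colour of an unused pair (2f ways), or take the negative of a
-- colour owned by exactly one other part, and the profile changes accordingly. Inside one part
-- reuse keeps the profile while every new colour makes one more colour reusable; this turns the
-- count into r-Stirling numbers (S(n, k) when the part starts with nothing to reuse) times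
-- weighted sequences of options, and those combine binomially. Running the three parts with
-- x = 2K colours gives the sum H₂. An odd palette adds the colour 0 = -0, which at most one
-- vertex can take; deleting that vertex gives the correction terms.

-- Finite sums

sumTo-cong : ∀ n {f g : ℕ → ℤ} → (∀ i → i ≤ n → f i ≡ g i) → sumTo n f ≡ sumTo n g
sumTo-cong zero    f≗g = f≗g 0 z≤n
sumTo-cong (suc n) f≗g =
  cong₂ _+_ (sumTo-cong n (λ i i≤n → f≗g i (ℕ.m≤n⇒m≤1+n i≤n))) (f≗g (suc n) ℕ.≤-refl)

sumTo-+ : ∀ n (f g : ℕ → ℤ) → sumTo n (λ i → f i + g i) ≡ sumTo n f + sumTo n g
sumTo-+ zero    f g = refl
sumTo-+ (suc n) f g = begin
  sumTo n (λ i → f i + g i) + (f (suc n) + g (suc n))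
    ≡⟨ cong (_+ (f (suc n) + g (suc n))) (sumTo-+ n f g) ⟩
  (sumTo n f + sumTo n g) + (f (suc n) + g (suc n))
    ≡⟨ interchange (sumTo n f) (sumTo n g) (f (suc n)) (g (suc n)) ⟩
  (sumTo n f + f (suc n)) + (sumTo n g + g (suc n)) ∎
  where
  interchange : ∀ a b c d → (a + b) + (c + d) ≡ (a + c) + (b + d)
  interchange = solve-∀

sumTo-*ˡ : ∀ n (a : ℤ) (f : ℕ → ℤ) → sumTo n (λ i → a * f i) ≡ a * sumTo n f
sumTo-*ˡ zero    a f = refl
sumTo-*ˡ (suc n) a f = trans (cong (_+ a * f (suc n)) (sumTo-*ˡ n a f))
                             (sym (ℤ.*-distribˡ-+ a (sumTo n f) (f (suc n))))

sumTo-linear : ∀ n (C : ℤ → ℤ) (K : ℤ) → (∀ x → C x ≡ K * x) → ∀ f →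
               C (sumTo n f) ≡ sumTo n (λ i → C (f i))
sumTo-linear n C K C≗K* f =
  trans (C≗K* (sumTo n f)) (trans (sym (sumTo-*ˡ n K f)) (sumTo-cong n (λ i _ → sym (C≗K* (f i)))))

sumTo-front : ∀ n (f : ℕ → ℤ) → sumTo (suc n) f ≡ f 0 + sumTo n (λ i → f (suc i))
sumTo-front zero    f = refl
sumTo-front (suc n) f = trans (cong (_+ f (suc (suc n))) (sumTo-front n f))
                              (ℤ.+-assoc (f 0) _ _)

sumTo-zero : ∀ n (f : ℕ → ℤ) → (∀ i → f i ≡ + 0) → sumTo n f ≡ + 0
sumTo-zero zero    f f≗0 = f≗0 0
sumTo-zero (suc n) f f≗0 = cong₂ _+_ (sumTo-zero n f f≗0) (f≗0 (suc n))

sumTo-swap : ∀ n m (f : ℕ → ℕ → ℤ) →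
  sumTo n (λ i → sumTo m (λ j → f i j)) ≡ sumTo m (λ j → sumTo n (λ i → f i j))
sumTo-swap zero    m f = refl
sumTo-swap (suc n) m f = begin
  sumTo n (λ i → sumTo m (f i)) + sumTo m (f (suc n))
    ≡⟨ cong (_+ sumTo m (f (suc n))) (sumTo-swap n m f) ⟩
  sumTo m (λ j → sumTo n (λ i → f i j)) + sumTo m (f (suc n))
    ≡⟨ sumTo-+ m (λ j → sumTo n (λ i → f i j)) (f (suc n)) ⟨
  sumTo m (λ j → sumTo (suc n) (λ i → f i j)) ∎

sumTo-extend : ∀ {n m} (f : ℕ → ℤ) → n ≤ m → (∀ i → n < i → f i ≡ + 0) → sumTo m f ≡ sumTo n f
sumTo-extend {n} f n≤m tail≗0 =
  trans (cong (λ k → sumTo k f) (sym (ℕ.m∸n+n≡m n≤m))) (go (_ ∸ n))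
  where
  go : ∀ d → sumTo (d ℕ.+ n) f ≡ sumTo n f
  go zero    = refl
  go (suc d) = trans (cong₂ _+_ (go d) (tail≗0 _ (s≤s (ℕ.m≤n+m n d)))) (ℤ.+-identityʳ _)

sumTo-pascal : ∀ k (T : ℕ → ℤ) →
  sumTo k (λ t → + (k C t) * T t) + sumTo k (λ t → + (k C t) * T (suc t))
  ≡ sumTo (suc k) (λ t → + (suc k C t) * T t)
sumTo-pascal k T = begin
  sumTo k (λ t → + (k C t) * T t) + sumTo k (λ t → + (k C t) * T (suc t))
    ≡⟨ cong (_+ sumTo k (λ t → + (k C t) * T (suc t)))
            (sumTo-extend (λ t → + (k C t) * T t) (ℕ.n≤1+n k)
                          (λ t k<t → cong (λ c → + c * T t) (k>n⇒nCk≡0 k<t))) ⟨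
  sumTo (suc k) (λ t → + (k C t) * T t) + sumTo k (λ t → + (k C t) * T (suc t))
    ≡⟨ cong (_+ sumTo k (λ t → + (k C t) * T (suc t))) (sumTo-front k _) ⟩
  (+ 1 * T 0 + sumTo k (λ t → + (k C suc t) * T (suc t))) + sumTo k (λ t → + (k C t) * T (suc t))
    ≡⟨ ℤ.+-assoc (+ 1 * T 0) _ _ ⟩
  + 1 * T 0 + (sumTo k (λ t → + (k C suc t) * T (suc t)) + sumTo k (λ t → + (k C t) * T (suc t)))
    ≡⟨ cong (_+_ (+ 1 * T 0)) (trans (sym (sumTo-+ k _ _)) (sumTo-cong k (λ t _ → pascal t))) ⟩
  + 1 * T 0 + sumTo k (λ t → + (suc k C suc t) * T (suc t))
    ≡⟨ sumTo-front k (λ t → + (suc k C t) * T t) ⟨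
  sumTo (suc k) (λ t → + (suc k C t) * T t) ∎
  where
  pascal : ∀ t → + (k C suc t) * T (suc t) + + (k C t) * T (suc t) ≡ + (suc k C suc t) * T (suc t)
  pascal t = begin
    + (k C suc t) * T (suc t) + + (k C t) * T (suc t)
      ≡⟨ ℤ.*-distribʳ-+ (T (suc t)) (+ (k C suc t)) (+ (k C t)) ⟨
    (+ (k C suc t) + + (k C t)) * T (suc t)
      ≡⟨ cong (_* T (suc t)) (ℤ.pos-+ (k C suc t) (k C t)) ⟨
    + (k C suc t ℕ.+ k C t) * T (suc t)
      ≡⟨ cong (λ c → + c * T (suc t)) (trans (ℕ.+-comm (k C suc t) (k C t)) (nCk+nC[k+1]≡[n+1]C[k+1] k t)) ⟩
    + (suc k C suc t) * T (suc t) ∎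

sumOver : {A : Set} → List A → (A → ℤ) → ℤ
sumOver []       F = + 0
sumOver (x ∷ xs) F = F x + sumOver xs F

sumOver-cong : ∀ {A : Set} (xs : List A) {F G : A → ℤ} → (∀ x → F x ≡ G x) → sumOver xs F ≡ sumOver xs G
sumOver-cong []       F≗G = refl
sumOver-cong (x ∷ xs) F≗G = cong₂ _+_ (F≗G x) (sumOver-cong xs F≗G)

sumOver-+ : ∀ {A : Set} (xs : List A) F G → sumOver xs (λ x → F x + G x) ≡ sumOver xs F + sumOver xs G
sumOver-+ []       F G = refl
sumOver-+ (x ∷ xs) F G = trans (cong (_+_ (F x + G x)) (sumOver-+ xs F G)) (interchange (F x) (G x) _ _)
  where
  interchange : ∀ a b c d → a + b + (c + d) ≡ (a + c) + (b + d)
  interchange = solve-∀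

sumOver-*ˡ : ∀ {A : Set} (xs : List A) a F → sumOver xs (λ x → a * F x) ≡ a * sumOver xs F
sumOver-*ˡ []       a F = sym (ℤ.*-zeroʳ a)
sumOver-*ˡ (x ∷ xs) a F = trans (cong (_+_ (a * F x)) (sumOver-*ˡ xs a F)) (sym (ℤ.*-distribˡ-+ a (F x) _))

sumOver-map : ∀ {A B : Set} (f : A → B) (xs : List A) F → sumOver (map f xs) F ≡ sumOver xs (λ x → F (f x))
sumOver-map f []       F = refl
sumOver-map f (x ∷ xs) F = cong (_+_ (F (f x))) (sumOver-map f xs F)

weighted : {S : Set} → List (ℤ × S) → (S → ℤ) → ℤ
weighted []              F = + 0
weighted ((w , σ) ∷ wσs) F = w * F σ + weighted wσs F

weighted-cong : {S : Set} (wσs : List (ℤ × S)) {F G : S → ℤ} → (∀ σ → F σ ≡ G σ) →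
                weighted wσs F ≡ weighted wσs G
weighted-cong []              F≗G = refl
weighted-cong ((w , σ) ∷ wσs) F≗G = cong₂ (λ u v → w * u + v) (F≗G σ) (weighted-cong wσs F≗G)

weighted-+ : ∀ {S : Set} (wσs : List (ℤ × S)) (F G : S → ℤ) →
             weighted wσs (λ σ → F σ + G σ) ≡ weighted wσs F + weighted wσs G
weighted-+ []              F G = refl
weighted-+ ((w , σ) ∷ wσs) F G =
  trans (cong (_+_ (w * (F σ + G σ))) (weighted-+ wσs F G)) (distrib w (F σ) (G σ) _ _)
  where
  distrib : ∀ w a b c d → w * (a + b) + (c + d) ≡ (w * a + c) + (w * b + d)
  distrib = solve-∀

weighted-sumTo : ∀ {S : Set} (wσs : List (ℤ × S)) n (a : S → ℕ → ℤ) (c : ℕ → ℤ) (F : ℕ → S → ℤ) →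
  All (λ wσ → ∀ k → a (proj₂ wσ) k ≡ c k) wσs →
  weighted wσs (λ σ → sumTo n (λ k → a σ k * F k σ)) ≡ sumTo n (λ k → c k * weighted wσs (F k))
weighted-sumTo []              n a c F []         = sym (sumTo-zero n _ (λ k → ℤ.*-zeroʳ (c k)))
weighted-sumTo ((w , σ) ∷ wσs) n a c F (aσ≗c ∷ as) = begin
  w * sumTo n (λ k → a σ k * F k σ) + weighted wσs (λ σ → sumTo n (λ k → a σ k * F k σ))
    ≡⟨ cong₂ _+_ (cong (w *_) (sumTo-cong n (λ k _ → cong (_* F k σ) (aσ≗c k))))
                 (weighted-sumTo wσs n a c F as) ⟩
  w * sumTo n (λ k → c k * F k σ) + sumTo n (λ k → c k * weighted wσs (F k))
    ≡⟨ cong (_+ sumTo n (λ k → c k * weighted wσs (F k))) (sumTo-*ˡ n w _) ⟨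
  sumTo n (λ k → w * (c k * F k σ)) + sumTo n (λ k → c k * weighted wσs (F k))
    ≡⟨ sumTo-+ n _ _ ⟨
  sumTo n (λ k → w * (c k * F k σ) + c k * weighted wσs (F k))
    ≡⟨ sumTo-cong n (λ k _ → factor w (c k) (F k σ) (weighted wσs (F k))) ⟩
  sumTo n (λ k → c k * (w * F k σ + weighted wσs (F k))) ∎
  where
  factor : ∀ w c x r → w * (c * x) + c * r ≡ c * (w * x + r)
  factor = solve-∀

weighted-sumOver : ∀ {A S : Set} (wσs : List (ℤ × S)) (xs : List A) (F : S → A → ℤ) →
  weighted wσs (λ σ → sumOver xs (F σ)) ≡ sumOver xs (λ x → weighted wσs (λ σ → F σ x))
weighted-sumOver []              xs F = sym (sumOver-zero xs)
  where
  sumOver-zero : ∀ xs → sumOver xs (λ _ → + 0) ≡ + 0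
  sumOver-zero []       = refl
  sumOver-zero (x ∷ xs) = trans (ℤ.+-identityˡ _) (sumOver-zero xs)
weighted-sumOver ((w , σ) ∷ wσs) xs F = begin
  w * sumOver xs (F σ) + weighted wσs (λ σ′ → sumOver xs (F σ′))
    ≡⟨ cong₂ _+_ (sumOver-*ˡ xs w (F σ)) (sym (weighted-sumOver wσs xs F)) ⟨
  sumOver xs (λ x → w * F σ x) + sumOver xs (λ x → weighted wσs (λ σ′ → F σ′ x))
    ≡⟨ sumOver-+ xs _ _ ⟨
  sumOver xs (λ x → w * F σ x + weighted wσs (λ σ′ → F σ′ x)) ∎

sumBelow : ℕ → (ℕ → ℤ) → ℤ
sumBelow zero    h = + 0
sumBelow (suc K) h = h 0 + sumBelow K (λ i → h (suc i))

sumBelow-cong : ∀ K {h h′ : ℕ → ℤ} → (∀ i → i < K → h i ≡ h′ i) → sumBelow K h ≡ sumBelow K h′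
sumBelow-cong zero    h≗h′ = refl
sumBelow-cong (suc K) h≗h′ =
  cong₂ _+_ (h≗h′ 0 (s≤s z≤n)) (sumBelow-cong K (λ i i<K → h≗h′ (suc i) (s≤s i<K)))

sumBelow-const : ∀ K c → sumBelow K (λ _ → c) ≡ + K * c
sumBelow-const zero    c = refl
sumBelow-const (suc K) c = trans (cong (_+_ c) (sumBelow-const K c)) (one-more c (+ K))
  where
  one-more : ∀ c k → c + k * c ≡ (+ 1 + k) * c
  one-more = solve-∀

sumBelow-update : ∀ K {h h′ : ℕ → ℤ} {i} → i < K → (∀ j → j ≢ i → h′ j ≡ h j) →
                  sumBelow K h′ ≡ sumBelow K h - h i + h′ i
sumBelow-update (suc K) {h} {h′} {zero} _ h′≗h = begin
  h′ 0 + sumBelow K (λ j → h′ (suc j))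
    ≡⟨ cong (_+_ (h′ 0)) (sumBelow-cong K (λ j _ → h′≗h (suc j) (λ ()))) ⟩
  h′ 0 + sumBelow K (λ j → h (suc j))
    ≡⟨ swap-in (h 0) (h′ 0) _ ⟩
  h 0 + sumBelow K (λ j → h (suc j)) - h 0 + h′ 0 ∎
  where
  swap-in : ∀ a b s → b + s ≡ a + s - a + b
  swap-in = solve-∀
sumBelow-update (suc K) {h} {h′} {suc i} (s≤s i<K) h′≗h = begin
  h′ 0 + sumBelow K (λ j → h′ (suc j))
    ≡⟨ cong₂ _+_ (h′≗h 0 (λ ()))
                 (sumBelow-update K i<K (λ j j≢i → h′≗h (suc j) (λ sj≡si → j≢i (ℕ.suc-injective sj≡si)))) ⟩
  h 0 + (sumBelow K (λ j → h (suc j)) - h (suc i) + h′ (suc i))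
    ≡⟨ assoc (h 0) _ _ _ ⟩
  h 0 + sumBelow K (λ j → h (suc j)) - h (suc i) + h′ (suc i) ∎
  where
  assoc : ∀ a s x y → a + (s - x + y) ≡ a + s - x + y
  assoc = solve-∀

-- Falling factorials

private
  single-factor : ∀ x → + 1 * (x - + 0) ≡ x * + 1
  single-factor = solve-∀

falling-suc : ∀ x n → falling x (suc n) ≡ x * falling (x - + 1) n
falling-suc x zero    = single-factor x
falling-suc x (suc n) = begin
  falling x (suc n) * (x - + suc n)
    ≡⟨ cong (_* (x - + suc n)) (falling-suc x n) ⟩
  x * falling (x - + 1) n * (x - (+ 1 + + n))
    ≡⟨ reassoc x (falling (x - + 1) n) (+ n) ⟩
  x * (falling (x - + 1) n * ((x - + 1) - + n)) ∎
  where
  reassoc : ∀ x F n → x * F * (x - (+ 1 + n)) ≡ x * (F * ((x - + 1) - n))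
  reassoc = solve-∀

falling2-suc : ∀ x n → falling2 x (suc n) ≡ x * falling2 (x - + 2) n
falling2-suc x zero    = single-factor x
falling2-suc x (suc n) = begin
  falling2 x (suc n) * (x - + (2 ℕ.* suc n))
    ≡⟨ cong₂ _*_ (falling2-suc x n) (cong (λ z → x - z) (ℤ.pos-* 2 (suc n))) ⟩
  x * falling2 (x - + 2) n * (x - + 2 * (+ 1 + + n))
    ≡⟨ reassoc x (falling2 (x - + 2) n) (+ n) ⟩
  x * (falling2 (x - + 2) n * ((x - + 2) - + 2 * + n))
    ≡⟨ cong (λ z → x * (falling2 (x - + 2) n * ((x - + 2) - z))) (ℤ.pos-* 2 n) ⟨
  x * (falling2 (x - + 2) n * ((x - + 2) - + (2 ℕ.* n))) ∎
  where
  reassoc : ∀ x F n → x * F * (x - + 2 * (+ 1 + n)) ≡ x * (F * ((x - + 2) - + 2 * n))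
  reassoc = solve-∀

falling2-+ : ∀ x a b → falling2 x (a ℕ.+ b) ≡ falling2 x a * falling2 (x - + 2 * + a) b
falling2-+ x zero    b = trans (cong (λ z → falling2 z b) (minus0 x)) (sym (ℤ.*-identityˡ _))
  where
  minus0 : ∀ x → x ≡ x - + 2 * + 0
  minus0 = solve-∀
falling2-+ x (suc a) b = begin
  falling2 x (suc (a ℕ.+ b))
    ≡⟨ falling2-suc x (a ℕ.+ b) ⟩
  x * falling2 (x - + 2) (a ℕ.+ b)
    ≡⟨ cong (x *_) (falling2-+ (x - + 2) a b) ⟩
  x * (falling2 (x - + 2) a * falling2 ((x - + 2) - + 2 * + a) b)
    ≡⟨ cong (λ z → x * (falling2 (x - + 2) a * falling2 z b)) (shift x (+ a)) ⟩
  x * (falling2 (x - + 2) a * falling2 (x - + 2 * + suc a) b)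
    ≡⟨ ℤ.*-assoc x _ _ ⟨
  x * falling2 (x - + 2) a * falling2 (x - + 2 * + suc a) b
    ≡⟨ cong (_* falling2 (x - + 2 * + suc a) b) (falling2-suc x a) ⟨
  falling2 x (suc a) * falling2 (x - + 2 * + suc a) b ∎
  where
  shift : ∀ x a → (x - + 2) - + 2 * a ≡ x - + 2 * (+ 1 + a)
  shift = solve-∀

-- Split 1 + i = (1 + s) + (i - s): the second part rebuilds the falling factorial of
-- length 1 + s, and Pascal's rule recombines the two binomials.
falling-ℕ : ∀ i s → falling (+ i) s ≡ + (s ! ℕ.* (i C s))
falling-ℕ i       zero    = refl
falling-ℕ zero    (suc s) = begin
  falling (+ 0) (suc s)         ≡⟨ falling-suc (+ 0) s ⟩
  + 0 * falling (- + 1) s       ≡⟨⟩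
  + 0                           ≡⟨ cong +_ (ℕ.*-zeroʳ (suc s !)) ⟨
  + (suc s ! ℕ.* (0 C suc s))   ∎
falling-ℕ (suc i) (suc s) = begin
  falling (+ suc i) (suc s)
    ≡⟨ falling-suc (+ suc i) s ⟩
  + suc i * falling (+ i) s
    ≡⟨ cong (+ suc i *_) (trans (falling-ℕ i s) (ℤ.pos-* (s !) (i C s))) ⟩
  (+ 1 + I) * (F * B)
    ≡⟨ split F I B S ⟩
  (+ 1 + S) * F * B + F * B * (I - S)
    ≡⟨ cong₂ _+_ (cong (_* B) (ℤ.pos-* (suc s) (s !))) next ⟨
  + (suc s !) * B + + (suc s !) * + (i C suc s)
    ≡⟨ ℤ.*-distribˡ-+ (+ (suc s !)) B (+ (i C suc s)) ⟨
  + (suc s !) * (+ (i C s) + + (i C suc s))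
    ≡⟨ cong (λ z → + (suc s !) * z) (ℤ.pos-+ (i C s) (i C suc s)) ⟨
  + (suc s !) * + (i C s ℕ.+ i C suc s)
    ≡⟨ cong (λ z → + (suc s !) * + z) (nCk+nC[k+1]≡[n+1]C[k+1] i s) ⟩
  + (suc s !) * + (suc i C suc s)
    ≡⟨ ℤ.pos-* (suc s !) (suc i C suc s) ⟨
  + (suc s ! ℕ.* (suc i C suc s)) ∎
  where
  I = + i
  S = + s
  F = + (s !)
  B = + (i C s)
  split : ∀ F I B S → (+ 1 + I) * (F * B) ≡ (+ 1 + S) * F * B + F * B * (I - S)
  split = solve-∀
  next : + (suc s !) * + (i C suc s) ≡ F * B * (I - S)
  next = begin
    + (suc s !) * + (i C suc s)   ≡⟨ ℤ.pos-* (suc s !) (i C suc s) ⟨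
    + (suc s ! ℕ.* (i C suc s))   ≡⟨ falling-ℕ i (suc s) ⟨
    falling (+ i) s * (I - S)     ≡⟨ cong (_* (I - S)) (trans (falling-ℕ i s) (ℤ.pos-* (s !) (i C s))) ⟩
    F * B * (I - S)               ∎

falling-vanish : ∀ {i s} → i < s → falling (+ i) s ≡ + 0
falling-vanish {i} {s} i<s = begin
  falling (+ i) s       ≡⟨ falling-ℕ i s ⟩
  + (s ! ℕ.* (i C s))   ≡⟨ cong (λ c → + (s ! ℕ.* c)) (k>n⇒nCk≡0 i<s) ⟩
  + (s ! ℕ.* 0)         ≡⟨ cong +_ (ℕ.*-zeroʳ (s !)) ⟩
  + 0                   ∎

falling2-split : ∀ q i {j k s t} → s ≤ j → t ≤ k →
  falling2 (+ (2 ℕ.* q)) (i ℕ.+ j ℕ.+ k ∸ t ∸ s)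
  ≡ falling2 (+ 2 * + q) i * falling2 (+ 2 * (+ q - + i)) (j ∸ s) * falling2 (+ 2 * ((+ q - + i) - + (j ∸ s))) (k ∸ t)
falling2-split q i {j} {k} {s} {t} s≤j t≤k = begin
  falling2 (+ (2 ℕ.* q)) (i ℕ.+ j ℕ.+ k ∸ t ∸ s)
    ≡⟨ cong₂ falling2 (ℤ.pos-* 2 q) index ⟩
  falling2 (+ 2 * + q) (i ℕ.+ (j ∸ s) ℕ.+ (k ∸ t))
    ≡⟨ falling2-+ (+ 2 * + q) (i ℕ.+ (j ∸ s)) (k ∸ t) ⟩
  falling2 (+ 2 * + q) (i ℕ.+ (j ∸ s)) * falling2 (+ 2 * + q - + 2 * + (i ℕ.+ (j ∸ s))) (k ∸ t)
    ≡⟨ cong₂ _*_ (falling2-+ (+ 2 * + q) i (j ∸ s))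
                 (cong (λ z → falling2 z (k ∸ t)) (trans (cong (λ z → + 2 * + q - + 2 * z) (ℤ.pos-+ i (j ∸ s)))
                                                          (shift₂ (+ q) (+ i) (+ (j ∸ s))))) ⟩
  falling2 (+ 2 * + q) i * falling2 (+ 2 * + q - + 2 * + i) (j ∸ s) * falling2 (+ 2 * ((+ q - + i) - + (j ∸ s))) (k ∸ t)
    ≡⟨ cong (λ z → falling2 (+ 2 * + q) i * falling2 z (j ∸ s) * falling2 (+ 2 * ((+ q - + i) - + (j ∸ s))) (k ∸ t))
            (shift₁ (+ q) (+ i)) ⟩
  falling2 (+ 2 * + q) i * falling2 (+ 2 * (+ q - + i)) (j ∸ s) * falling2 (+ 2 * ((+ q - + i) - + (j ∸ s))) (k ∸ t) ∎
  where
  shift₁ : ∀ q i → + 2 * q - + 2 * i ≡ + 2 * (q - i)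
  shift₁ = solve-∀
  shift₂ : ∀ q i d → + 2 * q - + 2 * (i + d) ≡ + 2 * ((q - i) - d)
  shift₂ = solve-∀
  index : i ℕ.+ j ℕ.+ k ∸ t ∸ s ≡ i ℕ.+ (j ∸ s) ℕ.+ (k ∸ t)
  index = begin
    i ℕ.+ j ℕ.+ k ∸ t ∸ s
      ≡⟨ ℕ.∸-+-assoc (i ℕ.+ j ℕ.+ k) t s ⟩
    i ℕ.+ j ℕ.+ k ∸ (t ℕ.+ s)
      ≡⟨ cong₂ (λ a b → i ℕ.+ a ℕ.+ b ∸ (t ℕ.+ s)) (ℕ.m∸n+n≡m s≤j) (ℕ.m∸n+n≡m t≤k) ⟨
    i ℕ.+ ((j ∸ s) ℕ.+ s) ℕ.+ ((k ∸ t) ℕ.+ t) ∸ (t ℕ.+ s)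
      ≡⟨ cong (_∸ (t ℕ.+ s)) (regroup i (j ∸ s) s (k ∸ t) t) ⟩
    i ℕ.+ (j ∸ s) ℕ.+ (k ∸ t) ℕ.+ (t ℕ.+ s) ∸ (t ℕ.+ s)
      ≡⟨ ℕ.m+n∸n≡m _ (t ℕ.+ s) ⟩
    i ℕ.+ (j ∸ s) ℕ.+ (k ∸ t) ∎
    where
    regroup : ∀ i a s b t → i ℕ.+ (a ℕ.+ s) ℕ.+ (b ℕ.+ t) ≡ i ℕ.+ a ℕ.+ b ℕ.+ (t ℕ.+ s)
    regroup = ℕ-solve-∀

-- The first two parts, using i and j pairs of which s are shared, leave i + j - 2s pairs half used.
+[i+j∸2s] : ∀ {i j s} → s ≤ i → s ≤ j → + (i ℕ.+ j ∸ 2 ℕ.* s) ≡ (+ i - + s) + + (j ∸ s)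
+[i+j∸2s] {i} {j} {s} s≤i s≤j = begin
  + (i ℕ.+ j ∸ 2 ℕ.* s)             ≡⟨ pos-∸ (ℕ.+-mono-≤ s≤i (subst (_≤ j) (sym (ℕ.+-identityʳ s)) s≤j)) ⟩
  + (i ℕ.+ j) - + (2 ℕ.* s)         ≡⟨ cong₂ _-_ (ℤ.pos-+ i j) (ℤ.pos-* 2 s) ⟩
  + i + + j - + 2 * + s             ≡⟨ regroup (+ i) (+ j) (+ s) ⟩
  (+ i - + s) + (+ j - + s)         ≡⟨ cong (_+_ (+ i - + s)) (pos-∸ s≤j) ⟨
  (+ i - + s) + + (j ∸ s)           ∎
  where
  pos-∸ : ∀ {m n} → n ≤ m → + (m ∸ n) ≡ + m - + n
  pos-∸ {m} {n} n≤m = sym (trans (ℤ.m-n≡m⊖n m n) (ℤ.⊖-≥ n≤m))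
  regroup : ∀ i j s → i + j - + 2 * s ≡ (i - s) + (j - s)
  regroup = solve-∀

-- r-Stirling numbers and reuse expansions

-- rStirling c n k = S_c(n + c, k + c), Broder's r-Stirling numbers, in the recursion that
-- reuse-weighted counts produce (the reuse weight grows with every new block).
rStirling : ℤ → ℕ → ℕ → ℤ
rStirling c zero    zero    = + 1
rStirling c zero    (suc k) = + 0
rStirling c (suc n) zero    = c * rStirling c n zero
rStirling c (suc n) (suc k) = c * rStirling c n (suc k) + rStirling (c + + 1) n k

rStirling-suc : ∀ c n k → rStirling (c + + 1) n k ≡ + suc k * rStirling c n (suc k) + rStirling c n k
rStirling-suc c zero    zero    = refl
rStirling-suc c zero    (suc k) = sym (cong (_+ + 0) (ℤ.*-zeroʳ (+ suc (suc k))))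
rStirling-suc c (suc n) zero    = begin
  (c + + 1) * rStirling (c + + 1) n 0
    ≡⟨ cong ((c + + 1) *_) (rStirling-suc c n 0) ⟩
  (c + + 1) * (+ 1 * a₁ + a₀)
    ≡⟨ regroup c a₀ a₁ ⟩
  + 1 * (c * a₁ + (+ 1 * a₁ + a₀)) + c * a₀
    ≡⟨ cong (λ z → + 1 * (c * a₁ + z) + c * a₀) (rStirling-suc c n 0) ⟨
  + 1 * (c * a₁ + rStirling (c + + 1) n 0) + c * a₀ ∎
  where
  a₀ = rStirling c n 0
  a₁ = rStirling c n 1
  regroup : ∀ c a₀ a₁ → (c + + 1) * (+ 1 * a₁ + a₀) ≡ + 1 * (c * a₁ + (+ 1 * a₁ + a₀)) + c * a₀
  regroup = solve-∀
rStirling-suc c (suc n) (suc k) = begin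
  (c + + 1) * rStirling (c + + 1) n (suc k) + rStirling (c + + 1 + + 1) n k
    ≡⟨ cong₂ (λ u v → (c + + 1) * u + v) (rStirling-suc c n (suc k)) (rStirling-suc (c + + 1) n k) ⟩
  (c + + 1) * (K₂ * a₂ + a₁) + (K₁ * rStirling (c + + 1) n (suc k) + rStirling (c + + 1) n k)
    ≡⟨ cong₂ (λ u v → (c + + 1) * (K₂ * a₂ + a₁) + (K₁ * u + v))
             (rStirling-suc c n (suc k)) (rStirling-suc c n k) ⟩
  (c + + 1) * (K₂ * a₂ + a₁) + (K₁ * (K₂ * a₂ + a₁) + (K₁ * a₁ + a₀))
    ≡⟨ regroup c (+ k) a₀ a₁ a₂ ⟩
  K₂ * (c * a₂ + (K₂ * a₂ + a₁)) + (c * a₁ + (K₁ * a₁ + a₀))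
    ≡⟨ cong₂ (λ u v → K₂ * (c * a₂ + u) + (c * a₁ + v)) (rStirling-suc c n (suc k)) (rStirling-suc c n k) ⟨
  K₂ * (c * a₂ + rStirling (c + + 1) n (suc k)) + (c * a₁ + rStirling (c + + 1) n k) ∎
  where
  K₁ = + 1 + + k
  K₂ = + 1 + (+ 1 + + k)
  a₀ = rStirling c n k
  a₁ = rStirling c n (suc k)
  a₂ = rStirling c n (suc (suc k))
  regroup : ∀ c k a₀ a₁ a₂ →
    (c + + 1) * ((+ 1 + (+ 1 + k)) * a₂ + a₁) + ((+ 1 + k) * ((+ 1 + (+ 1 + k)) * a₂ + a₁) + ((+ 1 + k) * a₁ + a₀))
    ≡ (+ 1 + (+ 1 + k)) * (c * a₂ + ((+ 1 + (+ 1 + k)) * a₂ + a₁)) + (c * a₁ + ((+ 1 + k) * a₁ + a₀))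
  regroup = solve-∀

rStirling-0 : ∀ n k → rStirling (+ 0) n k ≡ + stirling2 n k
rStirling-0 zero    zero    = refl
rStirling-0 zero    (suc k) = refl
rStirling-0 (suc n) zero    = refl
rStirling-0 (suc n) (suc k) = begin
  + 0 + rStirling (+ 0 + + 1) n k
    ≡⟨ ℤ.+-identityˡ _ ⟩
  rStirling (+ 0 + + 1) n k
    ≡⟨ rStirling-suc (+ 0) n k ⟩
  + suc k * rStirling (+ 0) n (suc k) + rStirling (+ 0) n k
    ≡⟨ cong₂ (λ u v → + suc k * u + v) (rStirling-0 n (suc k)) (rStirling-0 n k) ⟩
  + suc k * + stirling2 n (suc k) + + stirling2 n k
    ≡⟨ cong (_+ + stirling2 n k) (ℤ.pos-* (suc k) (stirling2 n (suc k))) ⟨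
  + (suc k ℕ.* stirling2 n (suc k)) + + stirling2 n k
    ≡⟨ ℤ.pos-+ (suc k ℕ.* stirling2 n (suc k)) (stirling2 n k) ⟨
  + stirling2 (suc n) (suc k) ∎

rStirling-vanish : ∀ c {n k} → n < k → rStirling c n k ≡ + 0
rStirling-vanish c {zero}  {suc k} n<k       = refl
rStirling-vanish c {suc n} {suc k} (s≤s n<k) =
  cong₂ _+_ (trans (cong (c *_) (rStirling-vanish c (ℕ.m≤n⇒m≤1+n n<k))) (ℤ.*-zeroʳ c))
            (rStirling-vanish (c + + 1) n<k)

rStirling-sumTo : ∀ c n (J : ℕ → ℤ) →
  c * sumTo n (λ k → rStirling c n k * J k) + sumTo n (λ k → rStirling (c + + 1) n k * J (suc k))
  ≡ sumTo (suc n) (λ k → rStirling c (suc n) k * J k)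
rStirling-sumTo c n J = begin
  c * sumTo n (λ k → A k * J k) + sumTo n (λ k → A′ k * J (suc k))
    ≡⟨ cong (λ u → c * u + sumTo n (λ k → A′ k * J (suc k))) drop-last ⟩
  c * (A 0 * J 0 + sumTo n (λ k → A (suc k) * J (suc k))) + sumTo n (λ k → A′ k * J (suc k))
    ≡⟨ regroup c (A 0) (J 0) _ _ ⟩
  c * A 0 * J 0 + (c * sumTo n (λ k → A (suc k) * J (suc k)) + sumTo n (λ k → A′ k * J (suc k)))
    ≡⟨ cong (λ u → c * A 0 * J 0 + (u + sumTo n (λ k → A′ k * J (suc k)))) (sumTo-*ˡ n c _) ⟨
  c * A 0 * J 0 + (sumTo n (λ k → c * (A (suc k) * J (suc k))) + sumTo n (λ k → A′ k * J (suc k)))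
    ≡⟨ cong (_+_ (c * A 0 * J 0)) (sumTo-+ n _ _) ⟨
  c * A 0 * J 0 + sumTo n (λ k → c * (A (suc k) * J (suc k)) + A′ k * J (suc k))
    ≡⟨ cong (_+_ (c * A 0 * J 0)) (sumTo-cong n (λ k _ → factor c (A (suc k)) (J (suc k)) (A′ k))) ⟩
  c * A 0 * J 0 + sumTo n (λ k → rStirling c (suc n) (suc k) * J (suc k))
    ≡⟨ sumTo-front n (λ k → rStirling c (suc n) k * J k) ⟨
  sumTo (suc n) (λ k → rStirling c (suc n) k * J k) ∎
  where
  A A′ : ℕ → ℤ
  A = rStirling c n
  A′ = rStirling (c + + 1) n
  regroup : ∀ c a j s₁ s₂ → c * (a * j + s₁) + s₂ ≡ c * a * j + (c * s₁ + s₂)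
  regroup = solve-∀
  factor : ∀ c a j b → c * (a * j) + b * j ≡ (c * a + b) * j
  factor = solve-∀
  drop-last : sumTo n (λ k → A k * J k) ≡ A 0 * J 0 + sumTo n (λ k → A (suc k) * J (suc k))
  drop-last = begin
    sumTo n (λ k → A k * J k)
      ≡⟨ sumTo-extend (λ k → A k * J k) (ℕ.n≤1+n n)
           (λ k n<k → trans (cong (_* J k) (rStirling-vanish c n<k)) (ℤ.*-zeroˡ (J k))) ⟨
    sumTo (suc n) (λ k → A k * J k)
      ≡⟨ sumTo-front n _ ⟩
    A 0 * J 0 + sumTo n (λ k → A (suc k) * J (suc k)) ∎

-- A count T that at each step either reuses one of reuse σ colours (keeping σ) or takes a
-- weighted option, each option raising the reuse weight by one, expands in r-Stirling numbers
-- over the number k of options taken.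
module ReuseExpansion {S : Set} (reuse : S → ℤ) (options : S → List (ℤ × S))
  (reuse-options : ∀ σ → All (λ wσ → reuse (proj₂ wσ) ≡ reuse σ + + 1) (options σ)) where

  optionPaths : (S → ℤ) → ℕ → S → ℤ
  optionPaths B zero    σ = B σ
  optionPaths B (suc k) σ = weighted (options σ) (optionPaths B k)

  expansion : (T : ℕ → S → ℤ) → (∀ n σ → T (suc n) σ ≡ reuse σ * T n σ + weighted (options σ) (T n)) →
              ∀ n σ → T n σ ≡ sumTo n (λ k → rStirling (reuse σ) n k * optionPaths (T 0) k σ)
  expansion T T-suc zero    σ = sym (ℤ.*-identityˡ (T 0 σ))
  expansion T T-suc (suc n) σ = begin
    T (suc n) σ
      ≡⟨ T-suc n σ ⟩
    reuse σ * T n σ + weighted (options σ) (T n)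
      ≡⟨ cong₂ (λ u v → reuse σ * u + v) (expansion T T-suc n σ)
                                         (weighted-cong (options σ) (expansion T T-suc n)) ⟩
    reuse σ * sumTo n (λ k → rStirling (reuse σ) n k * J k σ)
      + weighted (options σ) (λ σ′ → sumTo n (λ k → rStirling (reuse σ′) n k * J k σ′))
      ≡⟨ cong (_+_ (reuse σ * sumTo n (λ k → rStirling (reuse σ) n k * J k σ)))
              (weighted-sumTo (options σ) n (λ σ′ → rStirling (reuse σ′) n) (rStirling (reuse σ + + 1) n)
                              J shifted) ⟩
    reuse σ * sumTo n (λ k → rStirling (reuse σ) n k * J k σ)
      + sumTo n (λ k → rStirling (reuse σ + + 1) n k * J (suc k) σ)
      ≡⟨ rStirling-sumTo (reuse σ) n (λ k → J k σ) ⟩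
    sumTo (suc n) (λ k → rStirling (reuse σ) (suc n) k * J k σ) ∎
    where
    J : ℕ → S → ℤ
    J = optionPaths (T 0)
    shifted : All (λ wσ → ∀ k → rStirling (reuse (proj₂ wσ)) n k ≡ rStirling (reuse σ + + 1) n k) (options σ)
    shifted = All.map (λ eq k → cong (λ c → rStirling c n k) eq) (reuse-options σ)

-- Iterating two kinds of options, a fresh one of weight 2f (f ↦ f - 1, X ↦ X + 1) and a
-- claiming one of weight u (u ↦ u - 1, Y ↦ Y + 1), is a binomial convolution.
module TwoOptions (B : ℤ → ℤ → ℤ → ℤ → ℤ) where

  paths : ℕ → ℤ → ℤ → ℤ → ℤ → ℤ
  paths zero    f u X Y = B f u X Y
  paths (suc k) f u X Y = + 2 * f * paths k (f - + 1) u (X + + 1) Y + u * paths k f (u - + 1) X (Y + + 1)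

  term : ℤ → ℤ → ℤ → ℤ → ℕ → ℕ → ℤ
  term f u X Y k t =
    falling u t * falling2 (+ 2 * f) (k ∸ t) * B (f - + (k ∸ t)) (u - + t) (X + + (k ∸ t)) (Y + + t)

  term-fresh : ∀ f u X Y {k t} → t ≤ k → + 2 * f * term (f - + 1) u (X + + 1) Y k t ≡ term f u X Y (suc k) t
  term-fresh f u X Y {k} {t} t≤k = begin
    + 2 * f * (falling u t * falling2 (+ 2 * (f - + 1)) d * B ((f - + 1) - + d) (u - + t) ((X + + 1) + + d) (Y + + t))
      ≡⟨ cong₂ (λ a b → + 2 * f * (falling u t * falling2 a d * b))
               (two-pred f) (cong₂ (λ a b → B a (u - + t) b (Y + + t)) (pred-minus f (+ d)) (suc-plus X (+ d))) ⟩
    + 2 * f * (falling u t * falling2 (+ 2 * f - + 2) d * B (f - + suc d) (u - + t) (X + + suc d) (Y + + t))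
      ≡⟨ regroup (+ 2 * f) (falling u t) _ _ ⟩
    falling u t * (+ 2 * f * falling2 (+ 2 * f - + 2) d) * B (f - + suc d) (u - + t) (X + + suc d) (Y + + t)
      ≡⟨ cong (λ z → falling u t * z * B (f - + suc d) (u - + t) (X + + suc d) (Y + + t)) (falling2-suc (+ 2 * f) d) ⟨
    falling u t * falling2 (+ 2 * f) (suc d) * B (f - + suc d) (u - + t) (X + + suc d) (Y + + t)
      ≡⟨ cong (λ e → falling u t * falling2 (+ 2 * f) e * B (f - + e) (u - + t) (X + + e) (Y + + t))
              (ℕ.+-∸-assoc 1 t≤k) ⟨
    term f u X Y (suc k) t ∎
    where
    d = k ∸ t
    two-pred : ∀ f → + 2 * (f - + 1) ≡ + 2 * f - + 2
    two-pred = solve-∀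
    pred-minus : ∀ f d → (f - + 1) - d ≡ f - (+ 1 + d)
    pred-minus = solve-∀
    suc-plus : ∀ X d → (X + + 1) + d ≡ X + (+ 1 + d)
    suc-plus = solve-∀
    regroup : ∀ a b c e → a * (b * c * e) ≡ b * (a * c) * e
    regroup = solve-∀

  term-claim : ∀ f u X Y k t → u * term f (u - + 1) X (Y + + 1) k t ≡ term f u X Y (suc k) (suc t)
  term-claim f u X Y k t = begin
    u * (falling (u - + 1) t * falling2 (+ 2 * f) d * B (f - + d) ((u - + 1) - + t) (X + + d) ((Y + + 1) + + t))
      ≡⟨ cong₂ (λ a b → u * (falling (u - + 1) t * falling2 (+ 2 * f) d * B (f - + d) a (X + + d) b))
               (pred-minus u (+ t)) (suc-plus Y (+ t)) ⟩
    u * (falling (u - + 1) t * falling2 (+ 2 * f) d * B (f - + d) (u - + suc t) (X + + d) (Y + + suc t))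
      ≡⟨ regroup u _ _ _ ⟩
    u * falling (u - + 1) t * falling2 (+ 2 * f) d * B (f - + d) (u - + suc t) (X + + d) (Y + + suc t)
      ≡⟨ cong (λ z → z * falling2 (+ 2 * f) d * B (f - + d) (u - + suc t) (X + + d) (Y + + suc t))
              (falling-suc u t) ⟨
    term f u X Y (suc k) (suc t) ∎
    where
    d = k ∸ t
    pred-minus : ∀ u t → (u - + 1) - t ≡ u - (+ 1 + t)
    pred-minus = solve-∀
    suc-plus : ∀ Y t → (Y + + 1) + t ≡ Y + (+ 1 + t)
    suc-plus = solve-∀
    regroup : ∀ a b c e → a * (b * c * e) ≡ a * b * c * e
    regroup = solve-∀

  paths-binomial : ∀ k f u X Y → paths k f u X Y ≡ sumTo k (λ t → + (k C t) * term f u X Y k t)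
  paths-binomial zero    f u X Y = begin
    B f u X Y
      ≡⟨ cong₂ (λ a b → B a b X Y) (minus0 f) (minus0 u) ⟩
    B (f - + 0) (u - + 0) X Y
      ≡⟨ cong₂ (B (f - + 0) (u - + 0)) (plus0 X) (plus0 Y) ⟨
    B (f - + 0) (u - + 0) (X + + 0) (Y + + 0)
      ≡⟨ unit _ ⟩
    + 1 * (+ 1 * + 1 * B (f - + 0) (u - + 0) (X + + 0) (Y + + 0)) ∎
    where
    minus0 : ∀ a → a ≡ a - + 0
    minus0 = solve-∀
    plus0 : ∀ a → a + + 0 ≡ a
    plus0 = solve-∀
    unit : ∀ a → a ≡ + 1 * (+ 1 * + 1 * a)
    unit = solve-∀
  paths-binomial (suc k) f u X Y = begin
    + 2 * f * paths k (f - + 1) u (X + + 1) Y + u * paths k f (u - + 1) X (Y + + 1)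
      ≡⟨ cong₂ (λ a b → + 2 * f * a + u * b) (paths-binomial k (f - + 1) u (X + + 1) Y)
                                                (paths-binomial k f (u - + 1) X (Y + + 1)) ⟩
    + 2 * f * sumTo k (λ t → + (k C t) * term (f - + 1) u (X + + 1) Y k t)
      + u * sumTo k (λ t → + (k C t) * term f (u - + 1) X (Y + + 1) k t)
      ≡⟨ cong₂ _+_ (sumTo-*ˡ k (+ 2 * f) _) (sumTo-*ˡ k u _) ⟨
    sumTo k (λ t → + 2 * f * (+ (k C t) * term (f - + 1) u (X + + 1) Y k t))
      + sumTo k (λ t → u * (+ (k C t) * term f (u - + 1) X (Y + + 1) k t))
      ≡⟨ cong₂ _+_ (sumTo-cong k (λ t t≤k → trans (swap (+ 2 * f) (+ (k C t)) _)
                                                    (cong (+ (k C t) *_) (term-fresh f u X Y t≤k))))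
                   (sumTo-cong k (λ t _ → trans (swap u (+ (k C t)) _)
                                                (cong (+ (k C t) *_) (term-claim f u X Y k t)))) ⟩
    sumTo k (λ t → + (k C t) * term f u X Y (suc k) t) + sumTo k (λ t → + (k C t) * term f u X Y (suc k) (suc t))
      ≡⟨ sumTo-pascal k (term f u X Y (suc k)) ⟩
    sumTo (suc k) (λ t → + (suc k C t) * term f u X Y (suc k) t) ∎
    where
    swap : ∀ a b c → a * (b * c) ≡ b * (a * c)
    swap = solve-∀

-- Profiles

data Part : Set where
  p₁ p₂ p₃ : Part

-- How the two colours c, -c of a pair are used: by nobody, by one part only, by two different
-- parts (one colour each), or by one part with both colours (excluded for proper colourings).
data Status : Set where
  free                : Status
  half                : Part → Status
  full₁₂ full₁₃ full₂₃ : Status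
  clash               : Status

record Profile : Set where
  constructor profile
  field
    #free #half₁ #half₂ #half₃ #full₁₂ #full₁₃ #full₂₃ : ℤ
open Profile

adjust : Status → ℤ → Profile → Profile
adjust free      c σ = record σ { #free = #free σ + c }
adjust (half p₁) c σ = record σ { #half₁ = #half₁ σ + c }
adjust (half p₂) c σ = record σ { #half₂ = #half₂ σ + c }
adjust (half p₃) c σ = record σ { #half₃ = #half₃ σ + c }
adjust full₁₂    c σ = record σ { #full₁₂ = #full₁₂ σ + c }
adjust full₁₃    c σ = record σ { #full₁₃ = #full₁₃ σ + c }
adjust full₂₃    c σ = record σ { #full₂₃ = #full₂₃ σ + c }
adjust clash     c σ = σ

move : Status → Status → Profile → Profile
move s s′ σ = adjust s′ (+ 1) (adjust s (- + 1) σ)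

private
  cancel : ∀ x → x + - + 1 + + 1 ≡ x
  cancel = solve-∀

move-same : ∀ s σ → move s s σ ≡ σ
move-same free      σ = cong (λ x → record σ { #free = x }) (cancel (#free σ))
move-same (half p₁) σ = cong (λ x → record σ { #half₁ = x }) (cancel (#half₁ σ))
move-same (half p₂) σ = cong (λ x → record σ { #half₂ = x }) (cancel (#half₂ σ))
move-same (half p₃) σ = cong (λ x → record σ { #half₃ = x }) (cancel (#half₃ σ))
move-same full₁₂    σ = cong (λ x → record σ { #full₁₂ = x }) (cancel (#full₁₂ σ))
move-same full₁₃    σ = cong (λ x → record σ { #full₁₃ = x }) (cancel (#full₁₃ σ))
move-same full₂₃    σ = cong (λ x → record σ { #full₂₃ = x }) (cancel (#full₂₃ σ))
move-same clash     σ = refl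

reuse : Part → Profile → ℤ
reuse p₁ σ = #half₁ σ + #full₁₂ σ + #full₁₃ σ
reuse p₂ σ = #half₂ σ + #full₁₂ σ + #full₂₃ σ
reuse p₃ σ = #half₃ σ + #full₁₃ σ + #full₂₃ σ

options : Part → Profile → List (ℤ × Profile)
options p₁ σ = (+ 2 * #free σ , move free (half p₁) σ)
             ∷ (#half₂ σ , move (half p₂) full₁₂ σ) ∷ (#half₃ σ , move (half p₃) full₁₃ σ) ∷ []
options p₂ σ = (+ 2 * #free σ , move free (half p₂) σ)
             ∷ (#half₁ σ , move (half p₁) full₁₂ σ) ∷ (#half₃ σ , move (half p₃) full₂₃ σ) ∷ []
options p₃ σ = (+ 2 * #free σ , move free (half p₃) σ)
             ∷ (#half₁ σ , move (half p₁) full₁₃ σ) ∷ (#half₂ σ , move (half p₂) full₂₃ σ) ∷ []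

private
  raise₁ : ∀ a x y → (a + + 1) + x + y ≡ a + x + y + + 1
  raise₁ = solve-∀
  raise₂ : ∀ a x y → a + (x + + 1) + y ≡ a + x + y + + 1
  raise₂ = solve-∀
  raise₃ : ∀ a x y → a + x + (y + + 1) ≡ a + x + y + + 1
  raise₃ = solve-∀

reuse-options : ∀ g σ → All (λ wσ → reuse g (proj₂ wσ) ≡ reuse g σ + + 1) (options g σ)
reuse-options p₁ (profile _ a _ _ x y _) = raise₁ a x y ∷ raise₂ a x y ∷ raise₃ a x y ∷ []
reuse-options p₂ (profile _ _ b _ x _ z) = raise₁ b x z ∷ raise₂ b x z ∷ raise₃ b x z ∷ []
reuse-options p₃ (profile _ _ _ c _ y z) = raise₁ c y z ∷ raise₂ c y z ∷ raise₃ c y z ∷ []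

count : Profile → List Part → ℤ
count σ []       = + 1
count σ (g ∷ gs) = reuse g σ * count σ gs + weighted (options g σ) (λ σ′ → count σ′ gs)

initial : ℕ → Profile
initial K = profile (+ K) (+ 0) (+ 0) (+ 0) (+ 0) (+ 0) (+ 0)

labelList : ℕ → ℕ → ℕ → List Part
labelList l m n = replicate l p₁ ++ (replicate m p₂ ++ replicate n p₃)

deletions : {A : Set} → List A → List (List A)
deletions []       = []
deletions (x ∷ xs) = xs ∷ map (x ∷_) (deletions xs)

-- The odd palette adds the colour 0 = -0, which at most one vertex can take; it does not
-- belong to any pair, so taking it leaves the profile unchanged.
countZ : Profile → List Part → ℤ
countZ σ []       = + 1
countZ σ (g ∷ gs) = reuse g σ * countZ σ gs + weighted (options g σ) (λ σ′ → countZ σ′ gs) + count σ gs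

countZ≡count+deletions : ∀ gs σ → countZ σ gs ≡ count σ gs + sumOver (deletions gs) (count σ)
countZ≡count+deletions []       σ = refl
countZ≡count+deletions (g ∷ gs) σ = begin
  c * countZ σ gs + weighted (options g σ) (λ σ′ → countZ σ′ gs) + count σ gs
    ≡⟨ cong₂ (λ u v → c * u + v + count σ gs) (countZ≡count+deletions gs σ)
             (weighted-cong (options g σ) (countZ≡count+deletions gs)) ⟩
  c * (count σ gs + D σ) + weighted (options g σ) (λ σ′ → count σ′ gs + D σ′) + count σ gs
    ≡⟨ cong (λ z → c * (count σ gs + D σ) + z + count σ gs)
            (weighted-+ (options g σ) (λ σ′ → count σ′ gs) D) ⟩
  c * (count σ gs + D σ) + (weighted (options g σ) (λ σ′ → count σ′ gs) + weighted (options g σ) D) + count σ gs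
    ≡⟨ regroup c (count σ gs) (D σ) _ _ ⟩
  count σ (g ∷ gs) + (count σ gs + (c * D σ + weighted (options g σ) D))
    ≡⟨ cong (λ z → count σ (g ∷ gs) + (count σ gs + z)) prepend ⟩
  count σ (g ∷ gs) + (count σ gs + sumOver (map (g ∷_) (deletions gs)) (count σ)) ∎
  where
  c = reuse g σ
  D : Profile → ℤ
  D σ′ = sumOver (deletions gs) (count σ′)
  regroup : ∀ c p d w₁ w₂ → c * (p + d) + (w₁ + w₂) + p ≡ (c * p + w₁) + (p + (c * d + w₂))
  regroup = solve-∀
  prepend : c * D σ + weighted (options g σ) D ≡ sumOver (map (g ∷_) (deletions gs)) (count σ)
  prepend = begin
    c * D σ + weighted (options g σ) D
      ≡⟨ cong₂ _+_ (sumOver-*ˡ (deletions gs) c (count σ))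
                   (sym (weighted-sumOver (options g σ) (deletions gs) count)) ⟨
    sumOver (deletions gs) (λ d → c * count σ d)
      + sumOver (deletions gs) (λ d → weighted (options g σ) (λ σ′ → count σ′ d))
      ≡⟨ sumOver-+ (deletions gs) _ _ ⟨
    sumOver (deletions gs) (λ d → count σ (g ∷ d))
      ≡⟨ sumOver-map (g ∷_) (deletions gs) (count σ) ⟨
    sumOver (map (g ∷_) (deletions gs)) (count σ) ∎

-- Counting part by part

module Phase (g : Part) (rest : List Part) where
  open ReuseExpansion (reuse g) (options g) (reuse-options g) public

  count-replicate : ∀ n σ → count σ (replicate n g ++ rest)
                    ≡ sumTo n (λ k → rStirling (reuse g σ) n k * optionPaths (λ σ′ → count σ′ rest) k σ)
  count-replicate = expansion (λ n σ → count σ (replicate n g ++ rest)) (λ n σ → refl)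

module Last = Phase p₃ []

module LastOptions = TwoOptions (λ _ _ _ _ → + 1)

last-paths : ∀ k σ X Y →
  Last.optionPaths (λ _ → + 1) k σ ≡ LastOptions.paths k (#free σ) (#half₁ σ + #half₂ σ) X Y
last-paths zero    σ X Y = refl
last-paths (suc k) σ X Y = begin
  + 2 * f * J (move free (half p₃) σ) + (a * J (move (half p₁) full₁₃ σ) + (b * J (move (half p₂) full₂₃ σ) + + 0))
    ≡⟨ cong₂ (λ x y → + 2 * f * x + y) (last-paths k (move free (half p₃) σ) (X + + 1) Y)
         (cong₂ (λ x y → a * x + (b * y + + 0)) (last-paths k (move (half p₁) full₁₃ σ) X (Y + + 1))
                                                 (last-paths k (move (half p₂) full₂₃ σ) X (Y + + 1))) ⟩
  fresh + (a * claimed ((a - + 1) + b) + (b * claimed (a + (b - + 1)) + + 0))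
    ≡⟨ cong₂ (λ x y → fresh + (a * claimed x + (b * claimed y + + 0))) (pred-left a b) (pred-right a b) ⟩
  fresh + (a * claimed (a + b - + 1) + (b * claimed (a + b - + 1) + + 0))
    ≡⟨ merge fresh a b (claimed (a + b - + 1)) ⟩
  fresh + (a + b) * claimed (a + b - + 1) ∎
  where
  f = #free σ
  a = #half₁ σ
  b = #half₂ σ
  J : Profile → ℤ
  J = Last.optionPaths (λ _ → + 1) k
  fresh : ℤ
  fresh = + 2 * f * LastOptions.paths k (f - + 1) (a + b) (X + + 1) Y
  claimed : ℤ → ℤ
  claimed u = LastOptions.paths k f u X (Y + + 1)
  pred-left : ∀ a b → (a - + 1) + b ≡ a + b - + 1
  pred-left = solve-∀
  pred-right : ∀ a b → a + (b - + 1) ≡ a + b - + 1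
  pred-right = solve-∀
  merge : ∀ x a b p → x + (a * p + (b * p + + 0)) ≡ x + (a + b) * p
  merge = solve-∀

count-last : ∀ n σ → count σ (replicate n p₃) ≡
  sumTo n (λ k → rStirling (reuse p₃ σ) n k *
    sumTo k (λ t → + (k C t) * LastOptions.term (#free σ) (#half₁ σ + #half₂ σ) (+ 0) (+ 0) k t))
count-last n σ = begin
  count σ (replicate n p₃)
    ≡⟨ cong (count σ) (List.++-identityʳ (replicate n p₃)) ⟨
  count σ (replicate n p₃ ++ [])
    ≡⟨ Last.count-replicate n σ ⟩
  sumTo n (λ k → rStirling (reuse p₃ σ) n k * Last.optionPaths (λ _ → + 1) k σ)
    ≡⟨ sumTo-cong n (λ k _ → cong (rStirling (reuse p₃ σ) n k *_)
                                   (trans (last-paths k σ (+ 0) (+ 0)) (LastOptions.paths-binomial k _ _ _ _))) ⟩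
  sumTo n (λ k → rStirling (reuse p₃ σ) n k *
    sumTo k (λ t → + (k C t) * LastOptions.term (#free σ) (#half₁ σ + #half₂ σ) (+ 0) (+ 0) k t)) ∎

module Middle (n : ℕ) where
  module M = Phase p₂ (replicate n p₃)

  afterFirstTwo : ℤ → ℤ → ℤ → ℤ → Profile
  afterFirstTwo f u X Y = profile f u X (+ 0) Y (+ 0) (+ 0)

  lastCount : ℤ → ℤ → ℤ → ℤ → ℤ
  lastCount f u X Y = count (afterFirstTwo f u X Y) (replicate n p₃)

  open TwoOptions lastCount public

  middle-paths : ∀ j f u X Y →
    M.optionPaths (λ σ → count σ (replicate n p₃)) j (afterFirstTwo f u X Y) ≡ paths j f u X Y
  middle-paths zero    f u X Y = refl
  middle-paths (suc j) f u X Y = begin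
    + 2 * f * J (afterFirstTwo (f - + 1) u (X + + 1) Y) + (u * J (afterFirstTwo f (u - + 1) X (Y + + 1)) + + 0)
      ≡⟨ cong (_+_ (+ 2 * f * J (afterFirstTwo (f - + 1) u (X + + 1) Y))) (ℤ.+-identityʳ _) ⟩
    + 2 * f * J (afterFirstTwo (f - + 1) u (X + + 1) Y) + u * J (afterFirstTwo f (u - + 1) X (Y + + 1))
      ≡⟨ cong₂ (λ a b → + 2 * f * a + u * b) (middle-paths j (f - + 1) u (X + + 1) Y)
                                              (middle-paths j f (u - + 1) X (Y + + 1)) ⟩
    paths (suc j) f u X Y ∎
    where
    J : Profile → ℤ
    J = M.optionPaths (λ σ → count σ (replicate n p₃)) j

  count-middle : ∀ m f u → count (afterFirstTwo f u (+ 0) (+ 0)) (replicate m p₂ ++ replicate n p₃)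
                           ≡ sumTo m (λ j → + stirling2 m j * sumTo j (λ s → + (j C s) * term f u (+ 0) (+ 0) j s))
  count-middle m f u = trans (M.count-replicate m (afterFirstTwo f u (+ 0) (+ 0)))
    (sumTo-cong m (λ j _ → cong₂ _*_ (rStirling-0 m j)
                                     (trans (middle-paths j f u (+ 0) (+ 0)) (paths-binomial j f u (+ 0) (+ 0)))))

module First (m n : ℕ) where
  module F = Phase p₁ (replicate m p₂ ++ replicate n p₃)

  afterFirst : ℤ → ℤ → Profile
  afterFirst f a = profile f a (+ 0) (+ 0) (+ 0) (+ 0) (+ 0)

  rest : Profile → ℤ
  rest σ = count σ (replicate m p₂ ++ replicate n p₃)

  first-paths : ∀ i f a →
    F.optionPaths rest i (afterFirst f a) ≡ falling2 (+ 2 * f) i * rest (afterFirst (f - + i) (a + + i))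
  first-paths zero    f a = begin
    rest (afterFirst f a)                        ≡⟨ cong₂ (λ x y → rest (afterFirst x y)) (minus0 f) (plus0 a) ⟩
    rest (afterFirst (f - + 0) (a + + 0))        ≡⟨ ℤ.*-identityˡ _ ⟨
    + 1 * rest (afterFirst (f - + 0) (a + + 0))  ∎
    where
    minus0 : ∀ a → a ≡ a - + 0
    minus0 = solve-∀
    plus0 : ∀ a → a ≡ a + + 0
    plus0 = solve-∀
  first-paths (suc i) f a = begin
    + 2 * f * F.optionPaths rest i (afterFirst (f - + 1) (a + + 1)) + + 0
      ≡⟨ ℤ.+-identityʳ _ ⟩
    + 2 * f * F.optionPaths rest i (afterFirst (f - + 1) (a + + 1))
      ≡⟨ cong (+ 2 * f *_) (first-paths i (f - + 1) (a + + 1)) ⟩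
    + 2 * f * (falling2 (+ 2 * (f - + 1)) i * rest (afterFirst ((f - + 1) - + i) ((a + + 1) + + i)))
      ≡⟨ cong₂ (λ x y → + 2 * f * (falling2 x i * y)) (two-pred f)
               (cong₂ (λ x y → rest (afterFirst x y)) (pred-minus f (+ i)) (suc-plus a (+ i))) ⟩
    + 2 * f * (falling2 (+ 2 * f - + 2) i * rest (afterFirst (f - + suc i) (a + + suc i)))
      ≡⟨ ℤ.*-assoc (+ 2 * f) _ _ ⟨
    + 2 * f * falling2 (+ 2 * f - + 2) i * rest (afterFirst (f - + suc i) (a + + suc i))
      ≡⟨ cong (_* rest (afterFirst (f - + suc i) (a + + suc i))) (falling2-suc (+ 2 * f) i) ⟨
    falling2 (+ 2 * f) (suc i) * rest (afterFirst (f - + suc i) (a + + suc i)) ∎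
    where
    two-pred : ∀ f → + 2 * (f - + 1) ≡ + 2 * f - + 2
    two-pred = solve-∀
    pred-minus : ∀ f d → (f - + 1) - d ≡ f - (+ 1 + d)
    pred-minus = solve-∀
    suc-plus : ∀ X d → (X + + 1) + d ≡ X + (+ 1 + d)
    suc-plus = solve-∀

  count-first : ∀ l q → count (initial q) (labelList l m n)
    ≡ sumTo l (λ i → + stirling2 l i * (falling2 (+ 2 * + q) i * rest (afterFirst (+ q - + i) (+ i))))
  count-first l q = trans (F.count-replicate l (initial q))
    (sumTo-cong l (λ i _ → cong₂ _*_ (rStirling-0 l i) (first-paths i (+ q) (+ 0))))

module EvenCount (l m n q : ℕ) where
  open First m n using (count-first; rest; afterFirst)
  open Middle n using (count-middle; lastCount) renaming (term to middleTerm)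

  h₂Term : ℕ → ℕ → ℕ → ℕ → ℕ → ℤ
  h₂Term i j k s t =
    + ((s !) ℕ.* (i C s) ℕ.* (j C s) ℕ.* (k C t) ℕ.* stirling2 l i ℕ.* stirling2 m j ℕ.* stirling2 n k)
    * falling2 (+ (2 ℕ.* q)) (i ℕ.+ j ℕ.+ k ∸ t ∸ s) * falling (+ (i ℕ.+ j ∸ 2 ℕ.* s)) t

  outer : ℕ → ℕ → ℤ → ℤ
  outer i j x = + stirling2 l i * (falling2 (+ 2 * + q) i * (+ stirling2 m j * x))

  outer-zero : ∀ i j {x} → x ≡ + 0 → outer i j x ≡ + 0
  outer-zero i j refl
    rewrite ℤ.*-zeroʳ (+ stirling2 m j) | ℤ.*-zeroʳ (falling2 (+ 2 * + q) i) = ℤ.*-zeroʳ (+ stirling2 l i)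

  lastTerm : ℕ → ℕ → ℕ → ℕ → ℕ → ℤ
  lastTerm i j s k t =
    rStirling (+ 0) n k * (+ (k C t) * LastOptions.term ((+ q - + i) - + (j ∸ s)) ((+ i - + s) + + (j ∸ s)) (+ 0) (+ 0) k t)

  countTerm : ℕ → ℕ → ℕ → ℕ → ℕ → ℤ
  countTerm i j s k t = outer i j (+ (j C s) * (falling (+ i) s * falling2 (+ 2 * (+ q - + i)) (j ∸ s) * lastTerm i j s k t))

  countTerm≡h₂Term : ∀ {i j s k t} → s ≤ i → s ≤ j → t ≤ k → countTerm i j s k t ≡ h₂Term i j k s t
  countTerm≡h₂Term {i} {j} {s} {k} {t} s≤i s≤j t≤k = sym (begin
    h₂Term i j k s t
      ≡⟨ cong₂ (λ x y → x * y * falling (+ (i ℕ.+ j ∸ 2 ℕ.* s)) t) coefficient (falling2-split q i s≤j t≤k) ⟩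
    F * c * e * a * b * + stirling2 n k * (W * V * Z) * falling (+ (i ℕ.+ j ∸ 2 ℕ.* s)) t
      ≡⟨ cong₂ (λ x y → F * c * e * a * b * x * (W * V * Z) * falling y t)
               (sym (rStirling-0 n k)) (+[i+j∸2s] s≤i s≤j) ⟩
    F * c * e * a * b * r * (W * V * Z) * falling ((+ i - + s) + + (j ∸ s)) t
      ≡⟨ regroup a W b c F V r e (falling ((+ i - + s) + + (j ∸ s)) t) Z ⟩
    countTerm i j s k t ∎)
    where
    a = + stirling2 l i
    b = + stirling2 m j
    c = + (j C s)
    e = + (k C t)
    r = rStirling (+ 0) n k
    F = falling (+ i) s
    W = falling2 (+ 2 * + q) i
    V = falling2 (+ 2 * (+ q - + i)) (j ∸ s)
    Z = falling2 (+ 2 * ((+ q - + i) - + (j ∸ s))) (k ∸ t)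
    P₂ = (s !) ℕ.* (i C s)
    P₃ = P₂ ℕ.* (j C s)
    P₄ = P₃ ℕ.* (k C t)
    P₅ = P₄ ℕ.* stirling2 l i
    P₆ = P₅ ℕ.* stirling2 m j
    coefficient : + (P₆ ℕ.* stirling2 n k) ≡ F * c * e * a * b * + stirling2 n k
    coefficient = begin
      + (P₆ ℕ.* stirling2 n k)                   ≡⟨ ℤ.pos-* P₆ (stirling2 n k) ⟩
      + P₆ * + stirling2 n k                     ≡⟨ cong (_* + stirling2 n k) (ℤ.pos-* P₅ (stirling2 m j)) ⟩
      + P₅ * b * + stirling2 n k                 ≡⟨ cong (λ x → x * b * + stirling2 n k) (ℤ.pos-* P₄ (stirling2 l i)) ⟩
      + P₄ * a * b * + stirling2 n k             ≡⟨ cong (λ x → x * a * b * + stirling2 n k) (ℤ.pos-* P₃ (k C t)) ⟩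
      + P₃ * e * a * b * + stirling2 n k         ≡⟨ cong (λ x → x * e * a * b * + stirling2 n k) (ℤ.pos-* P₂ (j C s)) ⟩
      + P₂ * c * e * a * b * + stirling2 n k     ≡⟨ cong (λ x → x * c * e * a * b * + stirling2 n k) (falling-ℕ i s) ⟨
      F * c * e * a * b * + stirling2 n k        ∎
    regroup : ∀ a W b c F V r e H Z →
      F * c * e * a * b * r * (W * V * Z) * H ≡ a * (W * (b * (c * (F * V * (r * (e * (H * Z * + 1)))))))
    regroup = solve-∀

  countTerm-vanish : ∀ {i j s} → i ⊓ j < s → ∀ k t → countTerm i j s k t ≡ + 0
  countTerm-vanish {i} {j} {s} i⊓j<s k t with i ℕ.<? s
  ... | yes i<s = outer-zero i j (trans (cong (λ z → + (j C s) * (z * V * lastTerm i j s k t)) (falling-vanish i<s))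
                                        (ℤ.*-zeroʳ (+ (j C s))))
    where
    V = falling2 (+ 2 * (+ q - + i)) (j ∸ s)
  ... | no i≮s = outer-zero i j (cong (λ z → + z * (falling (+ i) s * V * lastTerm i j s k t)) (k>n⇒nCk≡0 j<s))
    where
    V = falling2 (+ 2 * (+ q - + i)) (j ∸ s)
    j<s : j < s
    j<s = ℕ.≰⇒> (λ s≤j → ℕ.<⇒≱ i⊓j<s (ℕ.⊓-glb (ℕ.≮⇒≥ i≮s) s≤j))

  block : ∀ i j → outer i j (sumTo j (λ s → + (j C s) * middleTerm (+ q - + i) (+ i) (+ 0) (+ 0) j s))
                  ≡ sumTo n (λ k → sumTo (i ⊓ j) (λ s → sumTo k (λ t → h₂Term i j k s t)))
  block i j = begin
    outer i j (sumTo j (λ s → + (j C s) * middleTerm (+ q - + i) (+ i) (+ 0) (+ 0) j s))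
      ≡⟨ sumTo-linear j (outer i j) (a * W * b) (three a W b) _ ⟩
    sumTo j (λ s → outer i j (+ (j C s) * middleTerm (+ q - + i) (+ i) (+ 0) (+ 0) j s))
      ≡⟨ sumTo-cong j (λ s _ → expand s) ⟩
    sumTo j (λ s → sumTo n (λ k → sumTo k (λ t → countTerm i j s k t)))
      ≡⟨ sumTo-extend _ (ℕ.m⊓n≤n i j) (λ s i⊓j<s →
           sumTo-zero n _ (λ k → sumTo-zero k _ (λ t → countTerm-vanish i⊓j<s k t))) ⟩
    sumTo (i ⊓ j) (λ s → sumTo n (λ k → sumTo k (λ t → countTerm i j s k t)))
      ≡⟨ sumTo-swap (i ⊓ j) n _ ⟩
    sumTo n (λ k → sumTo (i ⊓ j) (λ s → sumTo k (λ t → countTerm i j s k t)))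
      ≡⟨ sumTo-cong n (λ k _ → sumTo-cong (i ⊓ j) (λ s s≤i⊓j → sumTo-cong k (λ t t≤k →
           countTerm≡h₂Term (ℕ.≤-trans s≤i⊓j (ℕ.m⊓n≤m i j)) (ℕ.≤-trans s≤i⊓j (ℕ.m⊓n≤n i j)) t≤k)))
      ⟩
    sumTo n (λ k → sumTo (i ⊓ j) (λ s → sumTo k (λ t → h₂Term i j k s t))) ∎
    where
    a = + stirling2 l i
    W = falling2 (+ 2 * + q) i
    b = + stirling2 m j
    three : ∀ a W b x → a * (W * (b * x)) ≡ a * W * b * x
    three = solve-∀
    expand : ∀ s → outer i j (+ (j C s) * middleTerm (+ q - + i) (+ i) (+ 0) (+ 0) j s)
                   ≡ sumTo n (λ k → sumTo k (λ t → countTerm i j s k t))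
    expand s = begin
      C₁ (lastCount (+ q - + i - + (j ∸ s)) (+ i - + s) (+ (j ∸ s)) (+ s))
        ≡⟨ cong C₁ (count-last n _) ⟩
      C₁ (sumTo n (λ k → rStirling (+ 0) n k * sumTo k (λ t → + (k C t) * T k t)))
        ≡⟨ sumTo-linear n C₁ (a * W * b * c * FV) (five a W b c FV) _ ⟩
      sumTo n (λ k → C₁ (rStirling (+ 0) n k * sumTo k (λ t → + (k C t) * T k t)))
        ≡⟨ sumTo-cong n (λ k _ → sumTo-linear k (λ x → C₁ (rStirling (+ 0) n k * x))
                                   (a * W * b * c * FV * rStirling (+ 0) n k) (six a W b c FV (rStirling (+ 0) n k)) _) ⟩
      sumTo n (λ k → sumTo k (λ t → countTerm i j s k t)) ∎
      where
      c = + (j C s)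
      FV = falling (+ i) s * falling2 (+ 2 * (+ q - + i)) (j ∸ s)
      C₁ : ℤ → ℤ
      C₁ x = outer i j (c * (FV * x))
      T : ℕ → ℕ → ℤ
      T = LastOptions.term ((+ q - + i) - + (j ∸ s)) ((+ i - + s) + + (j ∸ s)) (+ 0) (+ 0)
      five : ∀ a W b c FV x → a * (W * (b * (c * (FV * x)))) ≡ a * W * b * c * FV * x
      five = solve-∀
      six : ∀ a W b c FV r x → a * (W * (b * (c * (FV * (r * x))))) ≡ a * W * b * c * FV * r * x
      six = solve-∀

  count-even : count (initial q) (labelList l m n) ≡ H₂ l m n (+ (2 ℕ.* q))
  count-even = begin
    count (initial q) (labelList l m n)
      ≡⟨ count-first l q ⟩
    sumTo l (λ i → + stirling2 l i * (falling2 (+ 2 * + q) i * rest (afterFirst (+ q - + i) (+ i))))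
      ≡⟨ sumTo-cong l (λ i _ → cong (λ x → + stirling2 l i * (falling2 (+ 2 * + q) i * x))
                                    (count-middle m (+ q - + i) (+ i))) ⟩
    sumTo l (λ i → + stirling2 l i * (falling2 (+ 2 * + q) i * sumTo m (λ j → + stirling2 m j * middleSum i j)))
      ≡⟨ sumTo-cong l (λ i _ → sumTo-linear m _ (+ stirling2 l i * falling2 (+ 2 * + q) i)
                                             (λ x → sym (ℤ.*-assoc (+ stirling2 l i) (falling2 (+ 2 * + q) i) x)) _) ⟩
    sumTo l (λ i → sumTo m (λ j → outer i j (middleSum i j)))
      ≡⟨ sumTo-cong l (λ i _ → sumTo-cong m (λ j _ → block i j)) ⟩
    H₂ l m n (+ (2 ℕ.* q)) ∎
    where
    middleSum : ℕ → ℕ → ℤ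
    middleSum i j = sumTo j (λ s → + (j C s) * middleTerm (+ q - + i) (+ i) (+ 0) (+ 0) j s)

-- Histories

_≟ₚ_ : DecidableEquality Part
p₁ ≟ₚ p₁ = yes refl
p₁ ≟ₚ p₂ = no λ ()
p₁ ≟ₚ p₃ = no λ ()
p₂ ≟ₚ p₁ = no λ ()
p₂ ≟ₚ p₂ = yes refl
p₂ ≟ₚ p₃ = no λ ()
p₃ ≟ₚ p₁ = no λ ()
p₃ ≟ₚ p₂ = no λ ()
p₃ ≟ₚ p₃ = yes refl

History : Set
History = List (Part × ℤ)

-- Vertices of one part are joined by negative edges, vertices of different parts by positive ones.
compatible : Part × ℤ → Part × ℤ → Bool
compatible (g , x) (h , y) = if does (g ≟ₚ h) then not (does (x ≟ - y)) else not (does (x ≟ y))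

fitsAfter : History → Part × ℤ → Bool
fitsAfter H p = allᵇ (compatible p) H

proper : History → Bool
proper []      = true
proper (p ∷ H) = fitsAfter H p ∧ proper H

owner : History → ℤ → Maybe Part
owner []            x = nothing
owner ((h , y) ∷ H) x = if does (x ≟ y) then just h else owner H x

owner-here : ∀ H g x → owner ((g , x) ∷ H) x ≡ just g
owner-here H g x rewrite dec-true (x ≟ x) refl = refl

owner-elsewhere : ∀ H g {x y} → x ≢ y → owner ((g , y) ∷ H) x ≡ owner H x
owner-elsewhere H g {x} {y} x≢y rewrite dec-false (x ≟ y) x≢y = refl

availableTo : Part → Maybe Part → Bool
availableTo g nothing  = true
availableTo g (just h) = does (h ≟ₚ g)

ownedBy : Part → Maybe Part → Bool
ownedBy g nothing  = false
ownedBy g (just h) = does (h ≟ₚ g)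

-- Part g may take a colour owned by a whose negative is owned by b.
allowed : Part → Maybe Part → Maybe Part → Bool
allowed g a b = availableTo g a ∧ not (ownedBy g b)

private
  ∧-true : ∀ {a b} → a ∧ b ≡ true → a ≡ true × b ≡ true
  ∧-true {true} {true} _ = refl , refl

  self : ∀ g → does (g ≟ₚ g) ≡ true
  self g = dec-true (g ≟ₚ g) refl

owned-other : ∀ {g h} b → availableTo h b ≡ true → g ≢ h → ownedBy g b ≡ false
owned-other nothing _ _ = refl
owned-other {g} {h} (just k) avail g≢h with k ≟ₚ h
... | yes refl = dec-false (k ≟ₚ g) (λ k≡g → g≢h (sym k≡g))
... | no  _    = case avail of λ ()

allowed-clash : ∀ g h → allowed g (just h) (just h) ≡ false
allowed-clash g h = ∧-inverseʳ (does (h ≟ₚ g))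

private
  reuse-own : ∀ g h a b → availableTo h a ≡ true →
    (if does (g ≟ₚ h) then true else false) ∧ (availableTo g a ∧ not (ownedBy g b))
    ≡ does (h ≟ₚ g) ∧ not (ownedBy g b)
  reuse-own g h a b avail with g ≟ₚ h
  ... | yes refl rewrite avail | self g = refl
  ... | no g≢h rewrite dec-false (h ≟ₚ g) (λ h≡g → g≢h (sym h≡g)) = refl

  claim-opposite : ∀ g h a b → availableTo h b ≡ true →
    (if does (g ≟ₚ h) then false else true) ∧ (availableTo g a ∧ not (ownedBy g b))
    ≡ availableTo g a ∧ not (does (h ≟ₚ g))
  claim-opposite g h a b avail with g ≟ₚ h
  ... | yes refl rewrite self g = sym (∧-zeroʳ (availableTo g a))
  ... | no g≢h rewrite dec-false (h ≟ₚ g) (λ h≡g → g≢h (sym h≡g)) | owned-other b avail g≢h = refl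

fitsAfter-extend : ∀ H g h x y → allowed h (owner H y) (owner H (- y)) ≡ true →
  compatible (g , x) (h , y) ∧ allowed g (owner H x) (owner H (- x))
  ≡ allowed g (owner ((h , y) ∷ H) x) (owner ((h , y) ∷ H) (- x))
fitsAfter-extend H g h x y ok with x ≟ y | - x ≟ y | ∧-true {availableTo h (owner H y)} ok
... | yes refl | yes -x≡x | _ rewrite dec-true (x ≟ - x) (sym -x≡x) | allowed-clash g h
  = cong (_∧ allowed g (owner H x) (owner H (- x))) (if-eta (does (g ≟ₚ h)))
... | yes refl | no -x≢x | avail , _ rewrite dec-false (x ≟ - x) (λ x≡-x → -x≢x (sym x≡-x))
  = reuse-own g h (owner H x) (owner H (- x)) avail
... | no x≢y | yes refl | avail , _ rewrite dec-true (x ≟ - - x) (sym (ℤ.neg-involutive x)) | ℤ.neg-involutive x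
  = claim-opposite g h (owner H x) (owner H (- x)) avail
... | no x≢y | no -x≢y | _
  rewrite dec-false (x ≟ - y) (λ x≡-y → -x≢y (trans (cong -_ x≡-y) (ℤ.neg-involutive y)))
  = cong (_∧ allowed g (owner H x) (owner H (- x))) (if-eta (does (g ≟ₚ h)))

-- In a proper history all vertices of one colour lie in one part, so compatibility with the
-- whole history is decided by the latest owners of x and -x.
fitsAfter-owner : ∀ H → proper H ≡ true → ∀ g x → fitsAfter H (g , x) ≡ allowed g (owner H x) (owner H (- x))
fitsAfter-owner []            _  g x = refl
fitsAfter-owner ((h , y) ∷ H) pr g x with ∧-true {fitsAfter H (h , y)} pr
... | fits-y , proper-H rewrite fitsAfter-owner H proper-H g x =
  fitsAfter-extend H g h x y (trans (sym (fitsAfter-owner H proper-H h y)) fits-y)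

shared : Part → Part → Status
shared p₁ p₁ = clash
shared p₁ p₂ = full₁₂
shared p₁ p₃ = full₁₃
shared p₂ p₁ = full₁₂
shared p₂ p₂ = clash
shared p₂ p₃ = full₂₃
shared p₃ p₁ = full₁₃
shared p₃ p₂ = full₂₃
shared p₃ p₃ = clash

status : Maybe Part → Maybe Part → Status
status nothing  nothing  = free
status (just g) nothing  = half g
status nothing  (just h) = half h
status (just g) (just h) = shared g h

status-comm : ∀ a b → status a b ≡ status b a
status-comm nothing   nothing   = refl
status-comm (just g)  nothing   = refl
status-comm nothing   (just h)  = refl
status-comm (just p₁) (just p₁) = refl
status-comm (just p₁) (just p₂) = refl
status-comm (just p₁) (just p₃) = refl
status-comm (just p₂) (just p₁) = refl
status-comm (just p₂) (just p₂) = refl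
status-comm (just p₂) (just p₃) = refl
status-comm (just p₃) (just p₁) = refl
status-comm (just p₃) (just p₂) = refl
status-comm (just p₃) (just p₃) = refl

dot : Profile → (Status → ℤ) → ℤ
dot σ Ψ = #free σ * Ψ free + #half₁ σ * Ψ (half p₁) + #half₂ σ * Ψ (half p₂) + #half₃ σ * Ψ (half p₃)
        + #full₁₂ σ * Ψ full₁₂ + #full₁₃ σ * Ψ full₁₃ + #full₂₃ σ * Ψ full₂₃

private
  at₁ : ∀ a b d e f g h A B D E F G H c → (a + c) * A + b * B + d * D + e * E + f * F + g * G + h * H
                                          ≡ a * A + b * B + d * D + e * E + f * F + g * G + h * H + c * A
  at₁ = solve-∀
  at₂ : ∀ a b d e f g h A B D E F G H c → a * A + (b + c) * B + d * D + e * E + f * F + g * G + h * H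
                                          ≡ a * A + b * B + d * D + e * E + f * F + g * G + h * H + c * B
  at₂ = solve-∀
  at₃ : ∀ a b d e f g h A B D E F G H c → a * A + b * B + (d + c) * D + e * E + f * F + g * G + h * H
                                          ≡ a * A + b * B + d * D + e * E + f * F + g * G + h * H + c * D
  at₃ = solve-∀
  at₄ : ∀ a b d e f g h A B D E F G H c → a * A + b * B + d * D + (e + c) * E + f * F + g * G + h * H
                                          ≡ a * A + b * B + d * D + e * E + f * F + g * G + h * H + c * E
  at₄ = solve-∀
  at₅ : ∀ a b d e f g h A B D E F G H c → a * A + b * B + d * D + e * E + (f + c) * F + g * G + h * H
                                          ≡ a * A + b * B + d * D + e * E + f * F + g * G + h * H + c * F
  at₅ = solve-∀
  at₆ : ∀ a b d e f g h A B D E F G H c → a * A + b * B + d * D + e * E + f * F + (g + c) * G + h * H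
                                          ≡ a * A + b * B + d * D + e * E + f * F + g * G + h * H + c * G
  at₆ = solve-∀
  at₇ : ∀ a b d e f g h A B D E F G H c → a * A + b * B + d * D + e * E + f * F + g * G + (h + c) * H
                                          ≡ a * A + b * B + d * D + e * E + f * F + g * G + h * H + c * H
  at₇ = solve-∀

dot-adjust : ∀ Ψ → Ψ clash ≡ + 0 → ∀ s c σ → dot (adjust s c σ) Ψ ≡ dot σ Ψ + c * Ψ s
dot-adjust Ψ _ free      c (profile a b d e f g h) =
  at₁ a b d e f g h (Ψ free) (Ψ (half p₁)) (Ψ (half p₂)) (Ψ (half p₃)) (Ψ full₁₂) (Ψ full₁₃) (Ψ full₂₃) c
dot-adjust Ψ _ (half p₁) c (profile a b d e f g h) =
  at₂ a b d e f g h (Ψ free) (Ψ (half p₁)) (Ψ (half p₂)) (Ψ (half p₃)) (Ψ full₁₂) (Ψ full₁₃) (Ψ full₂₃) c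
dot-adjust Ψ _ (half p₂) c (profile a b d e f g h) =
  at₃ a b d e f g h (Ψ free) (Ψ (half p₁)) (Ψ (half p₂)) (Ψ (half p₃)) (Ψ full₁₂) (Ψ full₁₃) (Ψ full₂₃) c
dot-adjust Ψ _ (half p₃) c (profile a b d e f g h) =
  at₄ a b d e f g h (Ψ free) (Ψ (half p₁)) (Ψ (half p₂)) (Ψ (half p₃)) (Ψ full₁₂) (Ψ full₁₃) (Ψ full₂₃) c
dot-adjust Ψ _ full₁₂    c (profile a b d e f g h) =
  at₅ a b d e f g h (Ψ free) (Ψ (half p₁)) (Ψ (half p₂)) (Ψ (half p₃)) (Ψ full₁₂) (Ψ full₁₃) (Ψ full₂₃) c
dot-adjust Ψ _ full₁₃    c (profile a b d e f g h) =
  at₆ a b d e f g h (Ψ free) (Ψ (half p₁)) (Ψ (half p₂)) (Ψ (half p₃)) (Ψ full₁₂) (Ψ full₁₃) (Ψ full₂₃) c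
dot-adjust Ψ _ full₂₃    c (profile a b d e f g h) =
  at₇ a b d e f g h (Ψ free) (Ψ (half p₁)) (Ψ (half p₂)) (Ψ (half p₃)) (Ψ full₁₂) (Ψ full₁₃) (Ψ full₂₃) c
dot-adjust Ψ Ψ-clash clash     c σ = begin
  dot σ Ψ               ≡⟨ ℤ.+-identityʳ (dot σ Ψ) ⟨
  dot σ Ψ + + 0         ≡⟨ cong (_+_ (dot σ Ψ)) (trans (sym (ℤ.*-zeroʳ c)) (cong (c *_) (sym Ψ-clash))) ⟩
  dot σ Ψ + c * Ψ clash ∎

dot-move : ∀ Ψ → Ψ clash ≡ + 0 → ∀ s s′ σ → dot (move s s′ σ) Ψ ≡ dot σ Ψ - Ψ s + Ψ s′
dot-move Ψ Ψ-clash s s′ σ = begin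
  dot (adjust s′ (+ 1) (adjust s (- + 1) σ)) Ψ   ≡⟨ dot-adjust Ψ Ψ-clash s′ (+ 1) _ ⟩
  dot (adjust s (- + 1) σ) Ψ + + 1 * Ψ s′        ≡⟨ cong (_+ + 1 * Ψ s′) (dot-adjust Ψ Ψ-clash s (- + 1) σ) ⟩
  dot σ Ψ + - + 1 * Ψ s + + 1 * Ψ s′             ≡⟨ simplify (dot σ Ψ) (Ψ s) (Ψ s′) ⟩
  dot σ Ψ - Ψ s + Ψ s′                           ∎
  where
  simplify : ∀ d a b → d + - + 1 * a + + 1 * b ≡ d - a + b
  simplify = solve-∀

pairStatus : History → ℕ → Status
pairStatus H i = status (owner H (+ suc i)) (owner H -[1+ i ])

-- σ records how many of the K pairs ±(i + 1) have each status in H, tested against every weighting.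
record Tallies (K : ℕ) (H : History) (σ : Profile) : Set where
  constructor tallies
  field
    tally : ∀ Ψ → Ψ clash ≡ + 0 → sumBelow K (λ i → Ψ (pairStatus H i)) ≡ dot σ Ψ

tallies-[] : ∀ K → Tallies K [] (profile (+ K) (+ 0) (+ 0) (+ 0) (+ 0) (+ 0) (+ 0))
tallies-[] K = tallies λ Ψ _ → trans (sumBelow-const K (Ψ free)) (pad (+ K * Ψ free))
  where
  pad : ∀ a → a ≡ a + + 0 + + 0 + + 0 + + 0 + + 0 + + 0
  pad = solve-∀

tallies-zero : ∀ {K H σ} g → Tallies K H σ → Tallies K ((g , + 0) ∷ H) σ
tallies-zero g (tallies tally) = tallies tally

private
  tallies-update : ∀ {K H H′ σ} i → i < K → (∀ j → j ≢ i → pairStatus H′ j ≡ pairStatus H j) →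
    Tallies K H σ → Tallies K H′ (move (pairStatus H i) (pairStatus H′ i) σ)
  tallies-update {K} {H} {H′} {σ} i i<K unchanged (tallies tally) = tallies λ Ψ Ψ-clash → begin
    sumBelow K (λ j → Ψ (pairStatus H′ j))
      ≡⟨ sumBelow-update K i<K (λ j j≢i → cong Ψ (unchanged j j≢i)) ⟩
    sumBelow K (λ j → Ψ (pairStatus H j)) - Ψ (pairStatus H i) + Ψ (pairStatus H′ i)
      ≡⟨ cong (λ d → d - Ψ (pairStatus H i) + Ψ (pairStatus H′ i)) (tally Ψ Ψ-clash) ⟩
    dot σ Ψ - Ψ (pairStatus H i) + Ψ (pairStatus H′ i)
      ≡⟨ dot-move Ψ Ψ-clash _ _ σ ⟨
    dot (move (pairStatus H i) (pairStatus H′ i) σ) Ψ ∎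

tallies-⁺ : ∀ {K H σ} g i → i < K → Tallies K H σ →
  Tallies K ((g , + suc i) ∷ H) (move (pairStatus H i) (status (just g) (owner H -[1+ i ])) σ)
tallies-⁺ {K} {H} {σ} g i i<K tallied =
  subst (λ s → Tallies K ((g , + suc i) ∷ H) (move (pairStatus H i) s σ))
        (cong (λ o → status o (owner H -[1+ i ])) (owner-here H g (+ suc i)))
        (tallies-update i i<K unchanged tallied)
  where
  unchanged : ∀ j → j ≢ i → pairStatus ((g , + suc i) ∷ H) j ≡ pairStatus H j
  unchanged j j≢i = cong (λ o → status o (owner H -[1+ j ]))
                         (owner-elsewhere H g (λ sj≡si → j≢i (ℕ.suc-injective (ℤ.+-injective sj≡si))))

tallies-⁻ : ∀ {K H σ} g i → i < K → Tallies K H σ →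
  Tallies K ((g , -[1+ i ]) ∷ H) (move (pairStatus H i) (status (owner H (+ suc i)) (just g)) σ)
tallies-⁻ {K} {H} {σ} g i i<K tallied =
  subst (λ s → Tallies K ((g , -[1+ i ]) ∷ H) (move (pairStatus H i) s σ))
        (cong (status (owner H (+ suc i))) (owner-here H g -[1+ i ]))
        (tallies-update i i<K unchanged tallied)
  where
  unchanged : ∀ j → j ≢ i → pairStatus ((g , -[1+ i ]) ∷ H) j ≡ pairStatus H j
  unchanged j j≢i = cong (status (owner H (+ suc j)))
                         (owner-elsewhere H g (λ -j≡-i → j≢i (ℤ.-[1+-injective -j≡-i)))

infix 7 [_]·_

[_]·_ : Bool → ℤ → ℤ
[ b ]· x = if b then x else + 0

-- What the next vertex, of part g, can do with a pair whose colours c and -c are owned by a and b.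
pairChoices : Part → (Profile → ℤ) → Profile → Maybe Part → Maybe Part → ℤ
pairChoices g F σ a b = [ allowed g a b ]· F (move (status a b) (status (just g) b) σ)
                      + [ allowed g b a ]· F (move (status a b) (status a (just g)) σ)

pairChoices-comm : ∀ g F σ a b → pairChoices g F σ a b ≡ pairChoices g F σ b a
pairChoices-comm g F σ a b
  rewrite status-comm a b | status-comm (just g) a | status-comm b (just g) =
    ℤ.+-comm ([ allowed g a b ]· F (move (status b a) (status (just g) b) σ))
             ([ allowed g b a ]· F (move (status b a) (status a (just g)) σ))

statusChoices : Part → (Profile → ℤ) → Profile → Status → ℤ
statusChoices g F σ free     = pairChoices g F σ nothing nothing
statusChoices g F σ (half h) = pairChoices g F σ (just h) nothing
statusChoices g F σ full₁₂   = pairChoices g F σ (just p₁) (just p₂)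
statusChoices g F σ full₁₃   = pairChoices g F σ (just p₁) (just p₃)
statusChoices g F σ full₂₃   = pairChoices g F σ (just p₂) (just p₃)
statusChoices g F σ clash    = + 0

pairChoices-status : ∀ g F σ a b → pairChoices g F σ a b ≡ statusChoices g F σ (status a b)
pairChoices-status g F σ nothing   nothing   = refl
pairChoices-status g F σ (just h)  nothing   = refl
pairChoices-status g F σ nothing   (just h)  = pairChoices-comm g F σ nothing (just h)
pairChoices-status g F σ (just p₁) (just p₂) = refl
pairChoices-status g F σ (just p₁) (just p₃) = refl
pairChoices-status g F σ (just p₂) (just p₃) = refl
pairChoices-status g F σ (just p₂) (just p₁) = pairChoices-comm g F σ (just p₂) (just p₁)
pairChoices-status g F σ (just p₃) (just p₁) = pairChoices-comm g F σ (just p₃) (just p₁)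
pairChoices-status g F σ (just p₃) (just p₂) = pairChoices-comm g F σ (just p₃) (just p₂)
pairChoices-status g F σ (just p₁) (just p₁) rewrite allowed-clash g p₁ = refl
pairChoices-status g F σ (just p₂) (just p₂) rewrite allowed-clash g p₂ = refl
pairChoices-status g F σ (just p₃) (just p₃) rewrite allowed-clash g p₃ = refl

private
  merge-reuse : ∀ {a x y R₁ R₂ R₃ S} → R₁ ≡ S → R₂ ≡ S → R₃ ≡ S →
                a * R₁ + x * R₂ + y * R₃ ≡ (a + x + y) * S
  merge-reuse {a} {x} {y} {S = S} refl refl refl = factor a x y S
    where
    factor : ∀ a x y S → a * S + x * S + y * S ≡ (a + x + y) * S
    factor = solve-∀

dot-statusChoices : ∀ g F σ → dot σ (statusChoices g F σ) ≡ reuse g σ * F σ + weighted (options g σ) F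
dot-statusChoices p₁ F σ@(profile f a b c x y z) = begin
  dot σ (statusChoices p₁ F σ)
    ≡⟨ regroup f a b c x y z _ _ _
               (F (move (half p₁) (half p₁) σ)) (F (move full₁₂ full₁₂ σ)) (F (move full₁₃ full₁₃ σ)) ⟩
  a * F (move (half p₁) (half p₁) σ) + x * F (move full₁₂ full₁₂ σ) + y * F (move full₁₃ full₁₃ σ)
    + weighted (options p₁ σ) F
    ≡⟨ cong (_+ weighted (options p₁ σ) F)
            (merge-reuse {a} {x} {y} (cong F (move-same (half p₁) σ)) (cong F (move-same full₁₂ σ))
                                   (cong F (move-same full₁₃ σ))) ⟩
  reuse p₁ σ * F σ + weighted (options p₁ σ) F ∎
  where
  regroup : ∀ f a b c x y z A B C R₁ R₂ R₃ →
    f * (A + A) + a * (R₁ + + 0) + b * (+ 0 + B) + c * (+ 0 + C) + x * (R₂ + + 0) + y * (R₃ + + 0) + z * (+ 0 + + 0)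
    ≡ a * R₁ + x * R₂ + y * R₃ + (+ 2 * f * A + (b * B + (c * C + + 0)))
  regroup = solve-∀
dot-statusChoices p₂ F σ@(profile f a b c x y z) = begin
  dot σ (statusChoices p₂ F σ)
    ≡⟨ regroup f a b c x y z _ _ _
               (F (move (half p₂) (half p₂) σ)) (F (move full₁₂ full₁₂ σ)) (F (move full₂₃ full₂₃ σ)) ⟩
  b * F (move (half p₂) (half p₂) σ) + x * F (move full₁₂ full₁₂ σ) + z * F (move full₂₃ full₂₃ σ)
    + weighted (options p₂ σ) F
    ≡⟨ cong (_+ weighted (options p₂ σ) F)
            (merge-reuse {b} {x} {z} (cong F (move-same (half p₂) σ)) (cong F (move-same full₁₂ σ))
                                   (cong F (move-same full₂₃ σ))) ⟩
  reuse p₂ σ * F σ + weighted (options p₂ σ) F ∎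
  where
  regroup : ∀ f a b c x y z A B C R₁ R₂ R₃ →
    f * (A + A) + a * (+ 0 + B) + b * (R₁ + + 0) + c * (+ 0 + C) + x * (+ 0 + R₂) + y * (+ 0 + + 0) + z * (R₃ + + 0)
    ≡ b * R₁ + x * R₂ + z * R₃ + (+ 2 * f * A + (a * B + (c * C + + 0)))
  regroup = solve-∀
dot-statusChoices p₃ F σ@(profile f a b c x y z) = begin
  dot σ (statusChoices p₃ F σ)
    ≡⟨ regroup f a b c x y z _ _ _
               (F (move (half p₃) (half p₃) σ)) (F (move full₁₃ full₁₃ σ)) (F (move full₂₃ full₂₃ σ)) ⟩
  c * F (move (half p₃) (half p₃) σ) + y * F (move full₁₃ full₁₃ σ) + z * F (move full₂₃ full₂₃ σ)
    + weighted (options p₃ σ) F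
    ≡⟨ cong (_+ weighted (options p₃ σ) F)
            (merge-reuse {c} {y} {z} (cong F (move-same (half p₃) σ)) (cong F (move-same full₁₃ σ))
                                   (cong F (move-same full₂₃ σ))) ⟩
  reuse p₃ σ * F σ + weighted (options p₃ σ) F ∎
  where
  regroup : ∀ f a b c x y z A B C R₁ R₂ R₃ →
    f * (A + A) + a * (+ 0 + B) + b * (+ 0 + C) + c * (R₁ + + 0) + x * (+ 0 + + 0) + y * (+ 0 + R₂) + z * (+ 0 + R₃)
    ≡ c * R₁ + y * R₂ + z * R₃ + (+ 2 * f * A + (a * B + (b * C + + 0)))
  regroup = solve-∀

sumBelow-pairChoices : ∀ K H σ g F → Tallies K H σ →
  sumBelow K (λ i → pairChoices g F σ (owner H (+ suc i)) (owner H -[1+ i ]))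
  ≡ reuse g σ * F σ + weighted (options g σ) F
sumBelow-pairChoices K H σ g F tallied = begin
  sumBelow K (λ i → pairChoices g F σ (owner H (+ suc i)) (owner H -[1+ i ]))
    ≡⟨ sumBelow-cong K (λ i _ → pairChoices-status g F σ (owner H (+ suc i)) (owner H -[1+ i ])) ⟩
  sumBelow K (λ i → statusChoices g F σ (pairStatus H i))
    ≡⟨ Tallies.tally tallied (statusChoices g F σ) refl ⟩
  dot σ (statusChoices g F σ)
    ≡⟨ dot-statusChoices g F σ ⟩
  reuse g σ * F σ + weighted (options g σ) F ∎

-- Counting colourings

countᵇ : {A : Set} → (A → Bool) → List A → ℕ
countᵇ p xs = length (filterᵇ p xs)

countᵇ-++ : ∀ {A : Set} (p : A → Bool) xs ys → countᵇ p (xs ++ ys) ≡ countᵇ p xs ℕ.+ countᵇ p ys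
countᵇ-++ p []       ys = refl
countᵇ-++ p (x ∷ xs) ys with p x
... | true  = cong suc (countᵇ-++ p xs ys)
... | false = countᵇ-++ p xs ys

countᵇ-concatMap : ∀ {A B : Set} (p : B → Bool) (f : A → List B) xs →
                   + countᵇ p (concatMap f xs) ≡ sumOver xs (λ x → + countᵇ p (f x))
countᵇ-concatMap p f []       = refl
countᵇ-concatMap p f (x ∷ xs) = begin
  + countᵇ p (f x ++ concatMap f xs)                    ≡⟨ cong +_ (countᵇ-++ p (f x) (concatMap f xs)) ⟩
  + (countᵇ p (f x) ℕ.+ countᵇ p (concatMap f xs))      ≡⟨ ℤ.pos-+ (countᵇ p (f x)) _ ⟩
  + countᵇ p (f x) + + countᵇ p (concatMap f xs)        ≡⟨ cong (_+_ (+ countᵇ p (f x))) (countᵇ-concatMap p f xs) ⟩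
  + countᵇ p (f x) + sumOver xs (λ x → + countᵇ p (f x)) ∎

countᵇ-map : ∀ {A B : Set} (p : B → Bool) (f : A → B) xs → countᵇ p (map f xs) ≡ countᵇ (λ x → p (f x)) xs
countᵇ-map p f []       = refl
countᵇ-map p f (x ∷ xs) with p (f x)
... | true  = cong suc (countᵇ-map p f xs)
... | false = countᵇ-map p f xs

countᵇ-cong : ∀ {A : Set} {p q : A → Bool} xs → (∀ x → p x ≡ q x) → countᵇ p xs ≡ countᵇ q xs
countᵇ-cong             []       p≗q = refl
countᵇ-cong {p = p} {q} (x ∷ xs) p≗q with p x | q x | p≗q x
... | true  | true  | refl = cong suc (countᵇ-cong xs p≗q)
... | false | false | refl = countᵇ-cong xs p≗q

countᵇ-guard : ∀ {A : Set} b (q : A → Bool) xs → + countᵇ (λ x → b ∧ q x) xs ≡ [ b ]· + countᵇ q xs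
countᵇ-guard true  q xs = refl
countᵇ-guard false q xs = cong +_ (go xs)
  where
  go : ∀ xs → countᵇ (λ _ → false) xs ≡ 0
  go []       = refl
  go (x ∷ xs) = go xs

fits : ∀ {N} → History → Vec (Part × ℤ) N → Bool
fits H []       = true
fits H (p ∷ ps) = fitsAfter H p ∧ fits (p ∷ H) ps

extensions : List ℤ → History → ∀ {N} → Vec Part N → ℕ
extensions cs H {N} parts = countᵇ (λ κ → fits H (V.zip parts κ)) (allVecs cs N)

extensions-step : ∀ cs H {N} g (parts : Vec Part N) →
  + extensions cs H (g ∷ parts) ≡ sumOver cs (λ x → [ fitsAfter H (g , x) ]· + extensions cs ((g , x) ∷ H) parts)
extensions-step cs H {N} g parts = begin
  + countᵇ (λ κ → fits H (V.zip (g ∷ parts) κ)) (concatMap (λ x → map (x ∷_) (allVecs cs N)) cs)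
    ≡⟨ countᵇ-concatMap _ (λ x → map (x ∷_) (allVecs cs N)) cs ⟩
  sumOver cs (λ x → + countᵇ (λ κ → fits H (V.zip (g ∷ parts) κ)) (map (x ∷_) (allVecs cs N)))
    ≡⟨ sumOver-cong cs (λ x → trans (cong +_ (countᵇ-map _ (x ∷_) (allVecs cs N)))
                                   (countᵇ-guard (fitsAfter H (g , x)) (λ κ → fits ((g , x) ∷ H) (V.zip parts κ))
                                                 (allVecs cs N))) ⟩
  sumOver cs (λ x → [ fitsAfter H (g , x) ]· + extensions cs ((g , x) ∷ H) parts) ∎

pairColours : ℕ → List ℤ
pairColours K = concatMap (λ i → + suc i ∷ - (+ suc i) ∷ []) (upTo K)

palette : Bool → ℕ → List ℤ
palette z K = (if z then + 0 ∷ [] else []) ++ pairColours K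

sumOver-pairColours : ∀ K (t : ℤ → ℤ) → sumOver (pairColours K) t ≡ sumBelow K (λ i → t (+ suc i) + t -[1+ i ])
sumOver-pairColours K t = go K (λ i → i)
  where
  go : ∀ K f → sumOver (concatMap (λ i → + suc i ∷ - (+ suc i) ∷ []) (applyUpTo f K)) t
               ≡ sumBelow K (λ i → t (+ suc (f i)) + t (- (+ suc (f i))))
  go zero    f = refl
  go (suc K) f = trans (cong (λ s → t (+ suc (f 0)) + (t (- (+ suc (f 0))) + s)) (go K (λ i → f (suc i))))
                       (sym (ℤ.+-assoc (t (+ suc (f 0))) _ _))

zeroFree : History → Bool
zeroFree H = is-nothing (owner H (+ 0))

countWith : Bool → Profile → List Part → ℤ
countWith true  = countZ
countWith false = count

guarded : ∀ b {x y} → (b ≡ true → x ≡ y) → [ b ]· x ≡ [ b ]· y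
guarded true  x≡y = x≡y refl
guarded false _   = refl

module _ (z : Bool) (K : ℕ) {N} (g : Part) (parts : Vec Part N) (H : History) (σ : Profile)
         (proper-H : proper H ≡ true) (tallied : Tallies K H σ)
         (IH : ∀ H′ σ′ → proper H′ ≡ true → Tallies K H′ σ′ →
               + extensions (palette z K) H′ parts ≡ countWith (z ∧ zeroFree H′) σ′ (V.toList parts)) where

  private
    F : Profile → ℤ
    F σ′ = countWith (z ∧ zeroFree H) σ′ (V.toList parts)

    extend : ∀ x σ′ → (allowed g (owner H x) (owner H (- x)) ≡ true → Tallies K ((g , x) ∷ H) σ′) →
             zeroFree ((g , x) ∷ H) ≡ zeroFree H →
             [ fitsAfter H (g , x) ]· + extensions (palette z K) ((g , x) ∷ H) parts
             ≡ [ allowed g (owner H x) (owner H (- x)) ]· F σ′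
    extend x σ′ tallied′ zero-kept rewrite fitsAfter-owner H proper-H g x =
      guarded (allowed g (owner H x) (owner H (- x))) λ ok →
        trans (IH ((g , x) ∷ H) σ′ (cong₂ _∧_ (trans (fitsAfter-owner H proper-H g x) ok) proper-H) (tallied′ ok))
              (cong (λ b → countWith (z ∧ b) σ′ (V.toList parts)) zero-kept)

  extensions-pairColours :
    sumOver (pairColours K) (λ x → [ fitsAfter H (g , x) ]· + extensions (palette z K) ((g , x) ∷ H) parts)
    ≡ reuse g σ * F σ + weighted (options g σ) F
  extensions-pairColours = begin
    sumOver (pairColours K) _
      ≡⟨ sumOver-pairColours K _ ⟩
    sumBelow K _
      ≡⟨ sumBelow-cong K (λ i i<K → cong₂ _+_ (extend (+ suc i) _ (λ _ → tallies-⁺ g i i<K tallied) refl)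
                                              (extend -[1+ i ] _ (λ _ → tallies-⁻ g i i<K tallied) refl)) ⟩
    sumBelow K (λ i → pairChoices g F σ (owner H (+ suc i)) (owner H -[1+ i ]))
      ≡⟨ sumBelow-pairChoices K H σ g F tallied ⟩
    reuse g σ * F σ + weighted (options g σ) F ∎

extensions≡countWith : ∀ z K {N} (parts : Vec Part N) H σ → proper H ≡ true → Tallies K H σ →
  + extensions (palette z K) H parts ≡ countWith (z ∧ zeroFree H) σ (V.toList parts)
extensions≡countWith z K [] H σ _ _ with z ∧ zeroFree H
... | true  = refl
... | false = refl
extensions≡countWith false K (g ∷ parts) H σ proper-H tallied = begin
  + extensions (palette false K) H (g ∷ parts)
    ≡⟨ extensions-step (palette false K) H g parts ⟩
  sumOver (pairColours K) _
    ≡⟨ extensions-pairColours false K g parts H σ proper-H tallied (extensions≡countWith false K parts) ⟩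
  count σ (g ∷ V.toList parts) ∎
extensions≡countWith true K (g ∷ parts) H σ proper-H tallied with owner H (+ 0) in zero-owner
... | nothing = begin
  + extensions (palette true K) H (g ∷ parts)
    ≡⟨ extensions-step (palette true K) H g parts ⟩
  [ fitsAfter H (g , + 0) ]· + extensions (palette true K) ((g , + 0) ∷ H) parts + sumOver (pairColours K) _
    ≡⟨ cong₂ _+_ zero-taken
                 (extensions-pairColours true K g parts H σ proper-H tallied (extensions≡countWith true K parts)) ⟩
  count σ gs + (reuse g σ * Z (zeroFree H) σ + weighted (options g σ) (Z (zeroFree H)))
    ≡⟨ cong (λ b → count σ gs + (reuse g σ * Z b σ + weighted (options g σ) (Z b))) (cong is-nothing zero-owner) ⟩
  count σ gs + (reuse g σ * countZ σ gs + weighted (options g σ) (λ σ′ → countZ σ′ gs))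
    ≡⟨ ℤ.+-comm (count σ gs) _ ⟩
  countZ σ (g ∷ gs) ∎
  where
  gs = V.toList parts
  Z : Bool → Profile → ℤ
  Z b σ′ = countWith b σ′ gs
  fits-0 : fitsAfter H (g , + 0) ≡ true
  fits-0 = trans (fitsAfter-owner H proper-H g (+ 0)) (cong (λ o → allowed g o o) zero-owner)
  zero-taken : [ fitsAfter H (g , + 0) ]· + extensions (palette true K) ((g , + 0) ∷ H) parts ≡ count σ gs
  zero-taken = begin
    [ fitsAfter H (g , + 0) ]· + extensions (palette true K) ((g , + 0) ∷ H) parts
      ≡⟨ cong (λ b → [ b ]· + extensions (palette true K) ((g , + 0) ∷ H) parts) fits-0 ⟩
    + extensions (palette true K) ((g , + 0) ∷ H) parts
      ≡⟨ extensions≡countWith true K parts ((g , + 0) ∷ H) σ (cong₂ _∧_ fits-0 proper-H)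
                              (tallies-zero g tallied) ⟩
    countWith (zeroFree ((g , + 0) ∷ H)) σ gs
      ≡⟨ cong (λ o → countWith (is-nothing o) σ gs) (owner-here H g (+ 0)) ⟩
    count σ gs ∎
... | just h = begin
  + extensions (palette true K) H (g ∷ parts)
    ≡⟨ extensions-step (palette true K) H g parts ⟩
  [ fitsAfter H (g , + 0) ]· + extensions (palette true K) ((g , + 0) ∷ H) parts + sumOver (pairColours K) _
    ≡⟨ cong₂ _+_ zero-blocked
                 (extensions-pairColours true K g parts H σ proper-H tallied (extensions≡countWith true K parts)) ⟩
  + 0 + (reuse g σ * Z (zeroFree H) σ + weighted (options g σ) (Z (zeroFree H)))
    ≡⟨ cong (λ b → + 0 + (reuse g σ * Z b σ + weighted (options g σ) (Z b))) (cong is-nothing zero-owner) ⟩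
  + 0 + count σ (g ∷ gs)
    ≡⟨ ℤ.+-identityˡ _ ⟩
  count σ (g ∷ gs) ∎
  where
  gs = V.toList parts
  Z : Bool → Profile → ℤ
  Z b σ′ = countWith b σ′ gs
  zero-blocked : [ fitsAfter H (g , + 0) ]· + extensions (palette true K) ((g , + 0) ∷ H) parts ≡ + 0
  zero-blocked rewrite fitsAfter-owner H proper-H g (+ 0) | zero-owner | allowed-clash g h = refl

-- The signed graph

allᵇ-cong : ∀ {A : Set} {p q : A → Bool} xs → (∀ x → p x ≡ q x) → allᵇ p xs ≡ allᵇ q xs
allᵇ-cong []       p≗q = refl
allᵇ-cong (x ∷ xs) p≗q = cong₂ _∧_ (p≗q x) (allᵇ-cong xs p≗q)

joinEdge : Part → Part → Bool → Maybe Sign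
joinEdge g h same = if same then nothing else just (if does (g ≟ₚ h) then neg else pos)

negK-edge : ∀ n g x y → edge (negK n) x y ≡ joinEdge g g (does (x ≟ᶠ y))
negK-edge n g x y rewrite self g = refl

join-edge : ∀ G H (ℓG : Fin (nv G) → Part) (ℓH : Fin (nv H) → Part) →
  (∀ x y → edge G x y ≡ joinEdge (ℓG x) (ℓG y) (does (x ≟ᶠ y))) →
  (∀ x y → edge H x y ≡ joinEdge (ℓH x) (ℓH y) (does (x ≟ᶠ y))) →
  (∀ x y → ℓG x ≢ ℓH y) →
  ∀ u v → edge (G ∨₊ H) u v
          ≡ joinEdge ([ ℓG , ℓH ]′ (splitAt (nv G) u)) ([ ℓG , ℓH ]′ (splitAt (nv G) v)) (does (u ≟ᶠ v))
join-edge G H ℓG ℓH edge-G edge-H apart u v with splitAt (nv G) u in eu | splitAt (nv G) v in ev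
... | inj₁ x | inj₁ y = trans (edge-G x y) (cong (joinEdge (ℓG x) (ℓG y)) (does-⇔ (mk⇔
        (λ x≡y → trans (sym (splitAt⁻¹-↑ˡ eu)) (trans (cong (_↑ˡ nv H) x≡y) (splitAt⁻¹-↑ˡ ev)))
        (λ u≡v → inj₁-injective (trans (sym eu) (trans (cong (splitAt (nv G)) u≡v) ev)))) (x ≟ᶠ y) (u ≟ᶠ v)))
... | inj₂ x | inj₂ y = trans (edge-H x y) (cong (joinEdge (ℓH x) (ℓH y)) (does-⇔ (mk⇔
        (λ x≡y → trans (sym (splitAt⁻¹-↑ʳ eu)) (trans (cong (nv G ↑ʳ_) x≡y) (splitAt⁻¹-↑ʳ ev)))
        (λ u≡v → inj₂-injective (trans (sym eu) (trans (cong (splitAt (nv G)) u≡v) ev)))) (x ≟ᶠ y) (u ≟ᶠ v)))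
... | inj₁ x | inj₂ y
  rewrite dec-false (u ≟ᶠ v) (λ u≡v → case trans (sym eu) (trans (cong (splitAt (nv G)) u≡v) ev) of λ ())
        | dec-false (ℓG x ≟ₚ ℓH y) (apart x y) = refl
... | inj₂ x | inj₁ y
  rewrite dec-false (u ≟ᶠ v) (λ u≡v → case trans (sym eu) (trans (cong (splitAt (nv G)) u≡v) ev) of λ ())
        | dec-false (ℓH x ≟ₚ ℓG y) (λ e → apart y x (sym e)) = refl

partOf : ∀ l m n → Fin (l ℕ.+ (m ℕ.+ n)) → Part
partOf l m n u = [ (λ _ → p₁) , (λ w → [ (λ _ → p₂) , (λ _ → p₃) ]′ (splitAt m w)) ]′ (splitAt l u)

tripleJoin-edge : ∀ l m n u v →
  edge (tripleJoin l m n) u v ≡ joinEdge (partOf l m n u) (partOf l m n v) (does (u ≟ᶠ v))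
tripleJoin-edge l m n =
  join-edge (negK l) (negK m ∨₊ negK n) (λ _ → p₁) _ (negK-edge l p₁)
    (join-edge (negK m) (negK n) (λ _ → p₂) (λ _ → p₃) (negK-edge m p₂) (negK-edge n p₃) (λ _ _ ()))
    first-apart
  where
  first-apart : ∀ x w → p₁ ≢ [ (λ _ → p₂) , (λ _ → p₃) ]′ (splitAt m w)
  first-apart x w with splitAt m w
  ... | inj₁ _ = λ ()
  ... | inj₂ _ = λ ()

edgeOK : ∀ {N} → Vec ℤ N → Maybe Sign → Fin N → Fin N → Bool
edgeOK κ nothing  u v = true
edgeOK κ (just s) u v = not (does (V.lookup κ u ≟ signed s (V.lookup κ v)))

-- The edge test in isProper is local to its definition; abstracting over the edge function
-- lets unification name it (test below), so that it can be compared with edgeOK.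
isProper-unfold : ∀ G κ →
  isProper G κ ≡ allᵇ (λ u → allᵇ (λ v → edgeOK κ (edge G u v) u v) (allFin (nv G))) (allFin (nv G))
isProper-unfold G κ with edge-tests κ _ (λ _ _ _ → refl) (λ _ _ → refl) (λ _ _ _ → refl) | edge G
  where
  edge-tests : ∀ {N} (κ : Vec ℤ N) (test : (Fin N → Fin N → Maybe Sign) → Fin N → Fin N → Bool) →
    (∀ e u v → test e u v ≡ test (λ _ _ → e u v) u v) →
    (∀ u v → test (λ _ _ → nothing) u v ≡ true) →
    (∀ s u v → test (λ _ _ → just s) u v ≡ not (does (V.lookup κ u ≟ signed s (V.lookup κ v)))) →
    ∀ e → allᵇ (λ u → allᵇ (λ v → test e u v) (allFin N)) (allFin N)
          ≡ allᵇ (λ u → allᵇ (λ v → edgeOK κ (e u v) u v) (allFin N)) (allFin N)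
  edge-tests κ test local test-nothing test-just e =
    allᵇ-cong (allFin _) (λ u → allᵇ-cong (allFin _) (λ v → pointwise u v))
    where
    pointwise : ∀ u v → test e u v ≡ edgeOK κ (e u v) u v
    pointwise u v with e u v | local e u v
    ... | nothing | eq = trans eq (test-nothing u v)
    ... | just s  | eq = trans eq (test-just s u v)
... | tests | e = tests e

edgeOK-joinEdge : ∀ {N} (κ : Vec ℤ N) g h same u v →
  edgeOK κ (joinEdge g h same) u v ≡ (if same then true else compatible (g , V.lookup κ u) (h , V.lookup κ v))
edgeOK-joinEdge κ g h true  u v = refl
edgeOK-joinEdge κ g h false u v with does (g ≟ₚ h)
... | true  = refl
... | false = refl

allFinᵇ : ∀ N → (Fin N → Bool) → Bool
allFinᵇ zero    p = true
allFinᵇ (suc N) p = p Fin.zero ∧ allFinᵇ N (λ i → p (Fin.suc i))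

allᵇ-allFin : ∀ N (p : Fin N → Bool) → allᵇ p (allFin N) ≡ allFinᵇ N p
allᵇ-allFin N p = go N (λ i → i)
  where
  go : ∀ K (f : Fin K → Fin N) → allᵇ p (tabulate f) ≡ allFinᵇ K (λ i → p (f i))
  go zero    f = refl
  go (suc K) f = cong (p (f Fin.zero) ∧_) (go K (λ i → f (Fin.suc i)))

allFinᵇ-cong : ∀ N {p q : Fin N → Bool} → (∀ i → p i ≡ q i) → allFinᵇ N p ≡ allFinᵇ N q
allFinᵇ-cong zero    p≗q = refl
allFinᵇ-cong (suc N) p≗q = cong₂ _∧_ (p≗q Fin.zero) (allFinᵇ-cong N (λ i → p≗q (Fin.suc i)))

allFinᵇ-∧ : ∀ N (p q : Fin N → Bool) → allFinᵇ N (λ i → p i ∧ q i) ≡ allFinᵇ N p ∧ allFinᵇ N q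
allFinᵇ-∧ zero    p q = refl
allFinᵇ-∧ (suc N) p q rewrite allFinᵇ-∧ N (λ i → p (Fin.suc i)) (λ i → q (Fin.suc i)) =
  ∧-interchange (p Fin.zero) (q Fin.zero) _ _

allVᵇ : ∀ {A : Set} {N} → (A → Bool) → Vec A N → Bool
allVᵇ p []       = true
allVᵇ p (a ∷ as) = p a ∧ allVᵇ p as

allFinᵇ-lookup : ∀ {A : Set} {N} (p : A → Bool) (as : Vec A N) →
                 allFinᵇ N (λ i → p (V.lookup as i)) ≡ allVᵇ p as
allFinᵇ-lookup p []       = refl
allFinᵇ-lookup p (a ∷ as) = cong (p a ∧_) (allFinᵇ-lookup p as)

pairwiseᵇ : ∀ {A : Set} {N} → (A → A → Bool) → Vec A N → Bool
pairwiseᵇ R []       = true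
pairwiseᵇ R (a ∷ as) = allVᵇ (λ b → R b a) as ∧ pairwiseᵇ R as

allPairs : ∀ {A : Set} {N} (R : A → A → Bool) → (∀ a b → R a b ≡ R b a) → (as : Vec A N) →
  allFinᵇ N (λ u → allFinᵇ N (λ v → if does (u ≟ᶠ v) then true else R (V.lookup as u) (V.lookup as v)))
  ≡ pairwiseᵇ R as
allPairs R R-comm []       = refl
allPairs {N = suc N} R R-comm (a ∷ as) = begin
  allFinᵇ N (λ v → R a (V.lookup as v)) ∧ allFinᵇ N (λ u → R (V.lookup as u) a ∧ allFinᵇ N (Q u))
    ≡⟨ cong₂ _∧_ (allFinᵇ-cong N (λ v → R-comm a (V.lookup as v)))
                 (allFinᵇ-∧ N (λ u → R (V.lookup as u) a) (λ u → allFinᵇ N (Q u))) ⟩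
  B ∧ (B ∧ allFinᵇ N (λ u → allFinᵇ N (Q u)))
    ≡⟨ cong (λ x → B ∧ (B ∧ x)) (allPairs R R-comm as) ⟩
  B ∧ (B ∧ pairwiseᵇ R as)
    ≡⟨ twice B _ ⟩
  B ∧ pairwiseᵇ R as
    ≡⟨ cong (_∧ pairwiseᵇ R as) (allFinᵇ-lookup (λ b → R b a) as) ⟩
  allVᵇ (λ b → R b a) as ∧ pairwiseᵇ R as ∎
  where
  Q : Fin N → Fin N → Bool
  Q u v = if does (u ≟ᶠ v) then true else R (V.lookup as u) (V.lookup as v)
  B = allFinᵇ N (λ u → R (V.lookup as u) a)
  twice : ∀ b c → b ∧ (b ∧ c) ≡ b ∧ c
  twice true  c = refl
  twice false c = refl

allVᵇ-∧ : ∀ {A : Set} {N} (p q : A → Bool) (as : Vec A N) →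
          allVᵇ (λ a → p a ∧ q a) as ≡ allVᵇ p as ∧ allVᵇ q as
allVᵇ-∧ p q []       = refl
allVᵇ-∧ p q (a ∷ as) rewrite allVᵇ-∧ p q as = ∧-interchange (p a) (q a) _ _

fits-pairwise : ∀ {N} H (ps : Vec (Part × ℤ) N) → fits H ps ≡ pairwiseᵇ compatible ps ∧ allVᵇ (fitsAfter H) ps
fits-pairwise H []       = refl
fits-pairwise H (p ∷ ps) rewrite fits-pairwise (p ∷ H) ps | allVᵇ-∧ (λ q → compatible q p) (fitsAfter H) ps =
  rearrange (fitsAfter H p) (pairwiseᵇ compatible ps) (allVᵇ (λ q → compatible q p) ps) (allVᵇ (fitsAfter H) ps)
  where
  rearrange : ∀ a w c d → a ∧ (w ∧ (c ∧ d)) ≡ (c ∧ w) ∧ (a ∧ d)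
  rearrange a w c d = begin
    a ∧ (w ∧ (c ∧ d))   ≡⟨ cong (a ∧_) (∧-assoc w c d) ⟨
    a ∧ ((w ∧ c) ∧ d)   ≡⟨ cong (λ x → a ∧ (x ∧ d)) (∧-comm w c) ⟩
    a ∧ ((c ∧ w) ∧ d)   ≡⟨ ∧-assoc a (c ∧ w) d ⟨
    (a ∧ (c ∧ w)) ∧ d   ≡⟨ cong (_∧ d) (∧-comm a (c ∧ w)) ⟩
    ((c ∧ w) ∧ a) ∧ d   ≡⟨ ∧-assoc (c ∧ w) a d ⟩
    (c ∧ w) ∧ (a ∧ d)   ∎

compatible-comm : ∀ p q → compatible p q ≡ compatible q p
compatible-comm (g , x) (h , y)
  rewrite does-⇔ (mk⇔ sym sym) (g ≟ₚ h) (h ≟ₚ g)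
        | does-⇔ (mk⇔ (λ x≡-y → trans (sym (ℤ.neg-involutive y)) (cong -_ (sym x≡-y)))
                      (λ y≡-x → trans (sym (ℤ.neg-involutive x)) (cong -_ (sym y≡-x)))) (x ≟ - y) (y ≟ - x)
        | does-⇔ (mk⇔ sym sym) (x ≟ y) (y ≟ x) = refl

labels : ∀ l m n → Vec Part (l ℕ.+ (m ℕ.+ n))
labels l m n = V.replicate l p₁ V.++ (V.replicate m p₂ V.++ V.replicate n p₃)

lookup-labels : ∀ l m n u → V.lookup (labels l m n) u ≡ partOf l m n u
lookup-labels l m n u rewrite V.lookup-splitAt l (V.replicate l p₁) (V.replicate m p₂ V.++ V.replicate n p₃) u
  with splitAt l u
... | inj₁ x = V.lookup-replicate x p₁
... | inj₂ w rewrite V.lookup-splitAt m (V.replicate m p₂) (V.replicate n p₃) w with splitAt m w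
...   | inj₁ y = V.lookup-replicate y p₂
...   | inj₂ z = V.lookup-replicate z p₃

isProper-tripleJoin : ∀ l m n κ → isProper (tripleJoin l m n) κ ≡ fits [] (V.zip (labels l m n) κ)
isProper-tripleJoin l m n κ = begin
  isProper (tripleJoin l m n) κ
    ≡⟨ isProper-unfold (tripleJoin l m n) κ ⟩
  allᵇ (λ u → allᵇ (λ v → edgeOK κ (edge (tripleJoin l m n) u v) u v) (allFin N)) (allFin N)
    ≡⟨ allᵇ-cong (allFin N) (λ u → allᵇ-cong (allFin N) (λ v → pointwise u v)) ⟩
  allᵇ (λ u → allᵇ (λ v → Q u v) (allFin N)) (allFin N)
    ≡⟨ trans (allᵇ-allFin N _) (allFinᵇ-cong N (λ u → allᵇ-allFin N (Q u))) ⟩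
  allFinᵇ N (λ u → allFinᵇ N (Q u))
    ≡⟨ allPairs compatible compatible-comm ws ⟩
  pairwiseᵇ compatible ws
    ≡⟨ trans (sym (∧-identityʳ _)) (cong (pairwiseᵇ compatible ws ∧_) (sym (fits-nothing-before ws))) ⟩
  pairwiseᵇ compatible ws ∧ allVᵇ (fitsAfter []) ws
    ≡⟨ fits-pairwise [] ws ⟨
  fits [] ws ∎
  where
  N = l ℕ.+ (m ℕ.+ n)
  ws = V.zip (labels l m n) κ
  Q : Fin N → Fin N → Bool
  Q u v = if does (u ≟ᶠ v) then true else compatible (V.lookup ws u) (V.lookup ws v)
  pointwise : ∀ u v → edgeOK κ (edge (tripleJoin l m n) u v) u v ≡ Q u v
  pointwise u v rewrite tripleJoin-edge l m n u v | V.lookup-zip u (labels l m n) κ | V.lookup-zip v (labels l m n) κ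
                      | lookup-labels l m n u | lookup-labels l m n v =
    edgeOK-joinEdge κ (partOf l m n u) (partOf l m n v) (does (u ≟ᶠ v)) u v
  fits-nothing-before : ∀ {M} (ps : Vec (Part × ℤ) M) → allVᵇ (fitsAfter []) ps ≡ true
  fits-nothing-before []       = refl
  fits-nothing-before (p ∷ ps) = fits-nothing-before ps

private
  even-mod : ∀ k → (2 ℕ.* k) ℕ.% 2 ≡ 0
  even-mod k = trans (cong (ℕ._% 2) (ℕ.*-comm 2 k)) (ℕ.m*n%n≡0 k 2)
  even-div : ∀ k → (2 ℕ.* k) ℕ./ 2 ≡ k
  even-div k = trans (cong (ℕ._/ 2) (ℕ.*-comm 2 k)) (ℕ.m*n/n≡m k 2)
  odd-mod : ∀ k → suc (2 ℕ.* k) ℕ.% 2 ≡ 1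
  odd-mod k = trans (cong (λ x → suc x ℕ.% 2) (ℕ.*-comm 2 k)) (ℕ.[m+kn]%n≡m%n 1 k 2)
  odd-div : ∀ k → suc (2 ℕ.* k) ℕ./ 2 ≡ k
  odd-div k = trans (cong (λ x → suc x ℕ./ 2) (ℕ.*-comm 2 k))
                    (trans (ℕ.+-distrib-/-∣ʳ 1 {k ℕ.* 2} {2} (divides k refl)) (ℕ.m*n/n≡m k 2))

colourSet-even : ∀ k → colourSet (2 ℕ.* k) ≡ palette false k
colourSet-even k rewrite even-mod k | even-div k = refl

colourSet-odd : ∀ k → colourSet (suc (2 ℕ.* k)) ≡ palette true k
colourSet-odd k rewrite odd-mod k | odd-div k = refl

toList-labels : ∀ l m n → V.toList (labels l m n) ≡ labelList l m n
toList-labels l m n = begin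
  V.toList (V.replicate l p₁ V.++ (V.replicate m p₂ V.++ V.replicate n p₃))
    ≡⟨ V.toList-++ (V.replicate l p₁) _ ⟩
  V.toList (V.replicate l p₁) ++ V.toList (V.replicate m p₂ V.++ V.replicate n p₃)
    ≡⟨ cong₂ _++_ (V.toList-replicate l p₁) (V.toList-++ (V.replicate m p₂) _) ⟩
  replicate l p₁ ++ (V.toList (V.replicate m p₂) ++ V.toList (V.replicate n p₃))
    ≡⟨ cong₂ (λ a b → replicate l p₁ ++ (a ++ b)) (V.toList-replicate m p₂) (V.toList-replicate n p₃) ⟩
  labelList l m n ∎

chromatic-tripleJoin : ∀ l m n lam z K → colourSet lam ≡ palette z K →
  + chromatic (tripleJoin l m n) lam ≡ countWith z (initial K) (labelList l m n)
chromatic-tripleJoin l m n lam z K colours = begin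
  + countᵇ (isProper (tripleJoin l m n)) (allVecs (colourSet lam) (l ℕ.+ (m ℕ.+ n)))
    ≡⟨ cong +_ (countᵇ-cong (allVecs (colourSet lam) (l ℕ.+ (m ℕ.+ n))) (isProper-tripleJoin l m n)) ⟩
  + extensions (colourSet lam) [] (labels l m n)
    ≡⟨ cong (λ cs → + extensions cs [] (labels l m n)) colours ⟩
  + extensions (palette z K) [] (labels l m n)
    ≡⟨ extensions≡countWith z K (labels l m n) [] (initial K) refl (tallies-[] K) ⟩
  countWith (z ∧ true) (initial K) (V.toList (labels l m n))
    ≡⟨ cong₂ (λ b ls → countWith b (initial K) ls) (∧-identityʳ z) (toList-labels l m n) ⟩
  countWith z (initial K) (labelList l m n) ∎

sumOver-deletions-replicate : ∀ {A : Set} k (g : A) R F →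
  sumOver (deletions (replicate k g ++ R)) F
  ≡ + k * F (replicate (pred k) g ++ R) + sumOver (deletions R) (λ r → F (replicate k g ++ r))
sumOver-deletions-replicate zero    g R F = sym (ℤ.+-identityˡ _)
sumOver-deletions-replicate (suc k) g R F = begin
  F (replicate k g ++ R) + sumOver (map (g ∷_) (deletions (replicate k g ++ R))) F
    ≡⟨ cong (_+_ (F (replicate k g ++ R))) (sumOver-map (g ∷_) (deletions (replicate k g ++ R)) F) ⟩
  F (replicate k g ++ R) + sumOver (deletions (replicate k g ++ R)) (λ d → F (g ∷ d))
    ≡⟨ cong (_+_ (F (replicate k g ++ R))) (sumOver-deletions-replicate k g R (λ d → F (g ∷ d))) ⟩
  F (replicate k g ++ R) + (+ k * F (g ∷ (replicate (pred k) g ++ R)) + S)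
    ≡⟨ cong (λ x → F (replicate k g ++ R) + (x + S)) (regrow k) ⟩
  F (replicate k g ++ R) + (+ k * F (replicate k g ++ R) + S)
    ≡⟨ one-more (F (replicate k g ++ R)) (+ k) S ⟩
  + suc k * F (replicate k g ++ R) + S ∎
  where
  S = sumOver (deletions R) (λ r → F (g ∷ (replicate k g ++ r)))
  regrow : ∀ k → + k * F (g ∷ (replicate (pred k) g ++ R)) ≡ + k * F (replicate k g ++ R)
  regrow zero    = refl
  regrow (suc k) = refl
  one-more : ∀ a k s → a + (k * a + s) ≡ (+ 1 + k) * a + s
  one-more = solve-∀

sumOver-deletions-labels : ∀ l m n F → sumOver (deletions (labelList l m n)) F
  ≡ + l * F (labelList (pred l) m n) + + m * F (labelList l (pred m) n) + + n * F (labelList l m (pred n))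
sumOver-deletions-labels l m n F = begin
  sumOver (deletions (labelList l m n)) F
    ≡⟨ sumOver-deletions-replicate l p₁ _ F ⟩
  + l * F (labelList (pred l) m n)
    + sumOver (deletions (replicate m p₂ ++ replicate n p₃)) (λ r → F (replicate l p₁ ++ r))
    ≡⟨ cong (_+_ (+ l * F (labelList (pred l) m n))) (sumOver-deletions-replicate m p₂ _ _) ⟩
  + l * F (labelList (pred l) m n) + (+ m * F (labelList l (pred m) n) + sumOver (deletions (replicate n p₃)) Fₙ)
    ≡⟨ cong (λ x → + l * F (labelList (pred l) m n) + (+ m * F (labelList l (pred m) n) + x)) last-block ⟩
  + l * F (labelList (pred l) m n) + (+ m * F (labelList l (pred m) n) + + n * F (labelList l m (pred n)))
    ≡⟨ ℤ.+-assoc (+ l * F (labelList (pred l) m n)) _ _ ⟨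
  + l * F (labelList (pred l) m n) + + m * F (labelList l (pred m) n) + + n * F (labelList l m (pred n)) ∎
  where
  Fₙ : List Part → ℤ
  Fₙ r = F (replicate l p₁ ++ (replicate m p₂ ++ r))
  last-block : sumOver (deletions (replicate n p₃)) Fₙ ≡ + n * F (labelList l m (pred n))
  last-block = begin
    sumOver (deletions (replicate n p₃)) Fₙ
      ≡⟨ cong (λ r → sumOver (deletions r) Fₙ) (List.++-identityʳ (replicate n p₃)) ⟨
    sumOver (deletions (replicate n p₃ ++ [])) Fₙ
      ≡⟨ sumOver-deletions-replicate n p₃ [] Fₙ ⟩
    + n * Fₙ (replicate (pred n) p₃ ++ []) + + 0
      ≡⟨ ℤ.+-identityʳ _ ⟩
    + n * Fₙ (replicate (pred n) p₃ ++ [])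
      ≡⟨ cong (λ r → + n * Fₙ r) (List.++-identityʳ (replicate (pred n) p₃)) ⟩
    + n * F (labelList l m (pred n)) ∎

times-pred : ∀ a (f : ℕ → ℤ) (h : ℤ → ℤ) → (∀ b → f b ≡ h (+ b)) →
             + a * f (pred a) ≡ + a * h (+ a - + 1)
times-pred zero    f h f≗h = refl
times-pred (suc a) f h f≗h = cong (+ suc a *_) (f≗h a)

chromatic-even : ∀ l m n k → + chromatic (tripleJoin l m n) (2 ℕ.* k) ≡ H₂ l m n (+ (2 ℕ.* k))
chromatic-even l m n k =
  trans (chromatic-tripleJoin l m n (2 ℕ.* k) false k (colourSet-even k)) (EvenCount.count-even l m n k)

chromatic-odd : ∀ l m n k → + chromatic (tripleJoin l m n) (suc (2 ℕ.* k))
  ≡ + chromatic (tripleJoin l m n) (2 ℕ.* k)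
    + + l * H₂ℤ (+ l - + 1) (+ m) (+ n) (+ suc (2 ℕ.* k) - + 1)
    + + m * H₂ℤ (+ l) (+ m - + 1) (+ n) (+ suc (2 ℕ.* k) - + 1)
    + + n * H₂ℤ (+ l) (+ m) (+ n - + 1) (+ suc (2 ℕ.* k) - + 1)
chromatic-odd l m n k = begin
  + chromatic (tripleJoin l m n) (suc (2 ℕ.* k))
    ≡⟨ chromatic-tripleJoin l m n (suc (2 ℕ.* k)) true k (colourSet-odd k) ⟩
  countZ (initial k) (labelList l m n)
    ≡⟨ countZ≡count+deletions (labelList l m n) (initial k) ⟩
  count (initial k) (labelList l m n) + sumOver (deletions (labelList l m n)) (count (initial k))
    ≡⟨ cong₂ _+_ (sym (chromatic-tripleJoin l m n (2 ℕ.* k) false k (colourSet-even k)))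
                 (sumOver-deletions-labels l m n (count (initial k))) ⟩
  E + (+ l * count (initial k) (labelList (pred l) m n) + + m * count (initial k) (labelList l (pred m) n)
       + + n * count (initial k) (labelList l m (pred n)))
    ≡⟨ cong (_+_ E) (cong₂ _+_ (cong₂ _+_ without-p₁ without-p₂) without-p₃) ⟩
  E + (+ l * Hₗ + + m * Hₘ + + n * Hₙ)
    ≡⟨ reassoc E (+ l * Hₗ) (+ m * Hₘ) (+ n * Hₙ) ⟩
  E + + l * Hₗ + + m * Hₘ + + n * Hₙ ∎
  where
  E = + chromatic (tripleJoin l m n) (2 ℕ.* k)
  x₀ = + suc (2 ℕ.* k) - + 1
  Hₗ = H₂ℤ (+ l - + 1) (+ m) (+ n) x₀
  Hₘ = H₂ℤ (+ l) (+ m - + 1) (+ n) x₀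
  Hₙ = H₂ℤ (+ l) (+ m) (+ n - + 1) x₀
  without-p₁ : + l * count (initial k) (labelList (pred l) m n) ≡ + l * Hₗ
  without-p₁ = times-pred l (λ b → count (initial k) (labelList b m n)) (λ x → H₂ℤ x (+ m) (+ n) x₀)
                            (λ b → EvenCount.count-even b m n k)
  without-p₂ : + m * count (initial k) (labelList l (pred m) n) ≡ + m * Hₘ
  without-p₂ = times-pred m (λ b → count (initial k) (labelList l b n)) (λ x → H₂ℤ (+ l) x (+ n) x₀)
                            (λ b → EvenCount.count-even l b n k)
  without-p₃ : + n * count (initial k) (labelList l m (pred n)) ≡ + n * Hₙ
  without-p₃ = times-pred n (λ b → count (initial k) (labelList l m b)) (λ x → H₂ℤ (+ l) (+ m) x x₀)
                            (λ b → EvenCount.count-even l m b k)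
  reassoc : ∀ x a b c → x + (a + b + c) ≡ x + a + b + c
  reassoc = solve-∀

proposition3p4 : (l m n : ℕ) →
    ((k : ℕ) → + chromatic (tripleJoin l m n) (2 ℕ.* k) ≡ H₂ l m n (+ (2 ℕ.* k)))
    × ((k : ℕ) → + chromatic (tripleJoin l m n) (suc (2 ℕ.* k))
        ≡ + chromatic (tripleJoin l m n) (2 ℕ.* k)
          + + l * H₂ℤ (+ l - + 1) (+ m) (+ n) (+ suc (2 ℕ.* k) - + 1)
          + + m * H₂ℤ (+ l) (+ m - + 1) (+ n) (+ suc (2 ℕ.* k) - + 1)
          + + n * H₂ℤ (+ l) (+ m) (+ n - + 1) (+ suc (2 ℕ.* k) - + 1))
proposition3p4 l m n = chromatic-even l m n , chromatic-odd l m n
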